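{- Suppose $A$ is a subset of density $\alpha$ of a regular $d$-dimensional Bohr set $B=B_0$ of $\mathbb{Z}_M$, and write $f_A=1_A-\alpha1_B$. Suppose also that $B_1,\dots,B_q$ are regular Bohr sets with $B_i\le_\rho B_{i-1}$ for all $i\in[q]$, where $\rho\le c/d$. Then either (1) $T_{\mathbf{B}}(1_A,\dots,1_A)\ge\alpha^t/4$, or (2) there exist functions $f_1,\dots,f_t:\mathbb{Z}_M\to[-1,1]$ and $i\in[t]$ such that $f_i=f_A$ and $|T_{\mathbf{B}}(f_1,\dots,f_t)|\gg\alpha^t$.
   Context: Setting: $V\in M_{r\times t}(\mathbb{Z})$ is translation-invariant (rows sum to $0$) of rank $r$ and complexity one, with $t\ge3$ and no zero columns; $\varphi:\mathbb{Z}^{q+1}\twoheadrightarrow\mathbb{Z}^t\cap\ker_{\mathbb{Q}}(V)$ is a linear surjection $\varphi(x_0,x)=x_0(1,\dots,1)+\psi(x)$ where $\psi=(\psi_1,\dots,\psi_t):\mathbb{Z}^q\to\mathbb{Z}^t$ is in exact $1$-normal form at every $i$ (i.e. for each $i$ there are $k<\ell$ in $[q]$ such that $\psi_i$ has nonzero coefficients of $x_k$ and $x_\ell$ while every $\psi_j$, $j\neq i$, has a zero coefficient at $x_k$ or at $x_\ell$); $\|\varphi\|$ is the sum of absolute values of its coefficients; $N\ge1$ and $M$ is a prime with $2\|\varphi\|N<M\le4\|\varphi\|N$. Constants $c$ (small), $C$ (large) and implied constants depend only on $q,t,\varphi$. A Bohr set with frequency set $\Gamma\subset\mathbb{Z}_M$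 and radius $\delta>0$ is $B(\Gamma,\delta)=\{x\in\mathbb{Z}_M:\|xr/M\|\le\delta\ \forall r\in\Gamma\}$ ($\|\cdot\|$ = distance to nearest integer), of dimension $d=|\Gamma|$; $B(\Gamma,\delta)_{|\rho}=B(\Gamma,\rho\delta)$; $B'\le_\rho B$ means $B'\subset B_{|\rho}$; $B$ is regular if $(1-2^6\rho d)|B|\le|B_{|1\pm\rho}|\le(1+2^6\rho d)|B|$ for all $0<\rho\le2^{ -6}/d$. The density of $A\subset B$ is $|A|/|B|$. For $\mathbf{B}=(B_0,\dots,B_q)$, $T_{\mathbf{B}}(f_1,\dots,f_t)=\mathbb{E}_{x_0\in B_0,\dots,x_q\in B_q}f_1[\varphi_1(x)]\cdots f_t[\varphi_t(x)]$, with $\varphi$ evaluated in $\mathbb{Z}_M$.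
   Formalization: The radii of the Bohr sets B_0,…,B_q and the parameter ρ are rational, and the functions f_1,…,f_t in alternative (2) take values in [-1,1] ∩ ℚ. -}

module Defs where

open import Data.Nat as ℕ using (ℕ; zero; suc; NonZero; _∸_; _⊔_; _⊓_)
open import Data.Nat.DivMod using (_mod_)
open import Data.Integer as ℤ using (ℤ; +_; _%ℕ_)
open import Data.Rational as ℚ using (ℚ; _/_)
open import Data.Rational.Properties using (_≤?_)
open import Data.Fin as Fin using (Fin; toℕ; inject₁)
open import Data.Fin.Subset using (Subset; _∈_)
open import Data.Fin.Subset.Properties using (_∈?_)
open import Data.Vec as Vec using (Vec; []; _∷_; lookup)
open import Data.Bool using (Bool; true; false; if_then_else_; _∧_)
open import Data.Product using (Σ; ∃; _×_; _,_)
open import Data.Sum using (_⊎_)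
open import Relation.Nullary using (¬_; does)
open import Relation.Binary.PropositionalEquality using (_≡_; _≢_)

Σℤ : (n : ℕ) → (Fin n → ℤ) → ℤ
Σℤ zero    f = + 0
Σℤ (suc n) f = f Fin.zero ℤ.+ Σℤ n (λ i → f (Fin.suc i))

Σℚ : (n : ℕ) → (Fin n → ℚ) → ℚ
Σℚ zero    f = ℚ.0ℚ
Σℚ (suc n) f = f Fin.zero ℚ.+ Σℚ n (λ i → f (Fin.suc i))

Πℚ : (n : ℕ) → (Fin n → ℚ) → ℚ
Πℚ zero    f = ℚ.1ℚ
Πℚ (suc n) f = f Fin.zero ℚ.* Πℚ n (λ i → f (Fin.suc i))

ΣVec : (M n : ℕ) → (Vec (Fin M) n → ℚ) → ℚ
ΣVec M zero    g = g []
ΣVec M (suc n) g = Σℚ M (λ a → ΣVec M n (λ xs → g (a ∷ xs)))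

count : (M : ℕ) → (Fin M → Bool) → ℕ
count zero    p = 0
count (suc M) p = (if p Fin.zero then 1 else 0) ℕ.+ count M (λ i → p (Fin.suc i))

_^ℚ_ : ℚ → ℕ → ℚ
a ^ℚ zero  = ℚ.1ℚ
a ^ℚ suc n = a ℚ.* (a ^ℚ n)

-- total inverse: inv 0 = 0, inv p = 1/p otherwise
-- (only ever applied to positive quantities below)
inv : ℚ → ℚ
inv p@(ℚ.mkℚ (+ zero) _ _)      = ℚ.0ℚ
inv p@(ℚ.mkℚ (+ suc _) _ _)     = ℚ.1/ p
inv p@(ℚ.mkℚ ℤ.-[1+ _ ] _ _)    = ℚ.1/ p

ℕ→ℚ : ℕ → ℚ
ℕ→ℚ n = (+ n) / 1

allFinB : (n : ℕ) → (Fin n → Bool) → Bool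
allFinB zero    p = true
allFinB (suc n) p = p Fin.zero ∧ allFinB n (λ i → p (Fin.suc i))

module _ (M : ℕ) .{{_ : NonZero M}} where

  reduce : ℤ → Fin M
  reduce z = (z %ℕ M) mod M

  -- ‖ k / M ‖ : distance of k/M (k ∈ ℤ_M) to the nearest integer
  ‖_/M‖ : Fin M → ℚ
  ‖ k /M‖ = (+ (toℕ k ⊓ (M ∸ toℕ k))) / M

  mulM : Fin M → Fin M → Fin M
  mulM x r = reduce (+ (toℕ x ℕ.* toℕ r))

  record Bohr : Set where
    constructor bohr
    field
      freq   : Subset M
      radius : ℚ

  open Bohr public

  dim : Bohr → ℕ
  dim B = Data.Fin.Subset.∣ freq B ∣

  inBohrᵇ : Bohr → Fin M → Bool
  inBohrᵇ B x = allFinB M (λ r → if does (r ∈? freq B)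
                                  then does (‖ mulM x r /M‖ ≤? radius B)
                                  else true)

  _∈B_ : Fin M → Bohr → Set
  x ∈B B = inBohrᵇ B x ≡ true

  size : Bohr → ℕ
  size B = count M (inBohrᵇ B)

  _∣_ : Bohr → ℚ → Bohr
  B ∣ ρ = bohr (freq B) (ρ ℚ.* radius B)

  _≤[_]_ : Bohr → ℚ → Bohr → Set
  B' ≤[ ρ ] B = ∀ x → x ∈B B' → x ∈B (B ∣ ρ)

  -- regularity: for all 0 < ρ ≤ 2^{-6}/d (written 2^6·ρ·d ≤ 1),
  -- (1 - 2^6ρd)|B| ≤ |B_{|1±ρ}| ≤ (1 + 2^6ρd)|B|
  Regular : Bohr → Set
  Regular B = ∀ (ρ : ℚ) → ℚ.0ℚ ℚ.< ρ → ℕ→ℚ 64 ℚ.* ρ ℚ.* ℕ→ℚ (dim B) ℚ.≤ ℚ.1ℚ →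
      ((ℚ.1ℚ ℚ.- ℕ→ℚ 64 ℚ.* ρ ℚ.* ℕ→ℚ (dim B)) ℚ.* ℕ→ℚ (size B) ℚ.≤ ℕ→ℚ (size (B ∣ (ℚ.1ℚ ℚ.+ ρ)))
      × ℕ→ℚ (size (B ∣ (ℚ.1ℚ ℚ.+ ρ))) ℚ.≤ (ℚ.1ℚ ℚ.+ ℕ→ℚ 64 ℚ.* ρ ℚ.* ℕ→ℚ (dim B)) ℚ.* ℕ→ℚ (size B))
    × ((ℚ.1ℚ ℚ.- ℕ→ℚ 64 ℚ.* ρ ℚ.* ℕ→ℚ (dim B)) ℚ.* ℕ→ℚ (size B) ℚ.≤ ℕ→ℚ (size (B ∣ (ℚ.1ℚ ℚ.- ρ)))
      × ℕ→ℚ (size (B ∣ (ℚ.1ℚ ℚ.- ρ))) ℚ.≤ (ℚ.1ℚ ℚ.+ ℕ→ℚ 64 ℚ.* ρ ℚ.* ℕ→ℚ (dim B)) ℚ.* ℕ→ℚ (size B))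

  𝟙B : Bohr → Fin M → ℚ
  𝟙B B x = if inBohrᵇ B x then ℚ.1ℚ else ℚ.0ℚ

  𝟙 : Subset M → Fin M → ℚ
  𝟙 A x = if does (x ∈? A) then ℚ.1ℚ else ℚ.0ℚ

  Bounded : (Fin M → ℚ) → Set
  Bounded f = ∀ x → (ℚ.- ℚ.1ℚ) ℚ.≤ f x × f x ℚ.≤ ℚ.1ℚ

-- Linear forms. A linear map φ : ℤ^{q+1} → ℤ^t is given by its integer
-- coefficient matrix φ i k (coefficient of x_k in φ_i), with x_0 the
-- first variable (index Fin.zero).

LinMap : ℕ → ℕ → Set
LinMap q t = Fin t → Fin (suc q) → ℤ

applyℤ : ∀ {q t} → LinMap q t → (Fin (suc q) → ℤ) → Fin t → ℤ
applyℤ {q} φ x i = Σℤ (suc q) (λ k → φ i k ℤ.* x k)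

applyM : ∀ {q t} (M : ℕ) .{{_ : NonZero M}} → LinMap q t → Vec (Fin M) (suc q) → Fin t → Fin M
applyM {q} M φ x i = reduce M (Σℤ (suc q) (λ k → φ i k ℤ.* (+ toℕ (lookup x k))))

normφ : ∀ {q t} → LinMap q t → ℕ
normφ {q} {t} φ = ℤ.∣ Σℤ t (λ i → Σℤ (suc q) (λ k → + ℤ.∣ φ i k ∣)) ∣

-- φ(x_0,x) = x_0(1,...,1) + ψ(x): coefficient of x_0 in every φ_i is 1
HasShape : ∀ {q t} → LinMap q t → Set
HasShape φ = ∀ i → φ i Fin.zero ≡ + 1

ψ : ∀ {q t} → LinMap q t → Fin t → Fin q → ℤ
ψ φ i k = φ i (Fin.suc k)

Exact1NormalForm : ∀ {q t} → LinMap q t → Set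
Exact1NormalForm {q} {t} φ = ∀ (i : Fin t) → Σ (Fin q) λ k → Σ (Fin q) λ ℓ →
  (k Fin.< ℓ) × ψ φ i k ≢ + 0 × ψ φ i ℓ ≢ + 0 ×
  (∀ (j : Fin t) → j ≢ i → ψ φ j k ≡ + 0 ⊎ ψ φ j ℓ ≡ + 0)

-- φ_i lies in the ℚ-linear span of {φ_j : P j}
-- (equivalently: n·φ_i = Σ_{j ∈ P} c_j φ_j for some integers n ≠ 0, c_j)
InSpan : ∀ {q t} → LinMap q t → (Fin t → Set) → Fin t → Set
InSpan {q} {t} φ P i = Σ ℤ λ n → n ≢ + 0 × Σ (Fin t → ℤ) λ c →
  (∀ j → ¬ P j → c j ≡ + 0) × (∀ k → n ℤ.* φ i k ≡ Σℤ t (λ j → c j ℤ.* φ j k))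

CSComplexity≤0 : ∀ {q t} → LinMap q t → Set
CSComplexity≤0 φ = ∀ i → ¬ InSpan φ (λ j → j ≢ i) i

CSComplexity≤1 : ∀ {q t} → LinMap q t → Set
CSComplexity≤1 {q} {t} φ = ∀ i → Σ (Fin t → Bool) λ cls →
  ¬ InSpan φ (λ j → j ≢ i × cls j ≡ true) i × ¬ InSpan φ (λ j → j ≢ i × cls j ≡ false) i

-- V ∈ M_{r×t}(ℤ): translation-invariant, rank r, no zero columns,
-- and φ : ℤ^{q+1} ↠ ℤ^t ∩ ker_ℚ(V), and V has complexity one
-- (Cauchy–Schwarz complexity of the parametrising forms is exactly one).
Setting : (q t r : ℕ) → (Fin r → Fin t → ℤ) → LinMap q t → Set
Setting q t r V φ =
    (∀ a → Σℤ t (V a) ≡ + 0)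
  × (∀ (c : Fin r → ℤ) → (∀ i → Σℤ r (λ a → c a ℤ.* V a i) ≡ + 0) → ∀ a → c a ≡ + 0)
  × (∀ i → ∃ λ a → V a i ≢ + 0)
  × (∀ x a → Σℤ t (λ i → V a i ℤ.* applyℤ φ x i) ≡ + 0)
  × (∀ (y : Fin t → ℤ) → (∀ a → Σℤ t (λ i → V a i ℤ.* y i) ≡ + 0) →
       ∃ λ (x : Fin (suc q) → ℤ) → ∀ i → applyℤ φ x i ≡ y i)
  × CSComplexity≤1 φ × ¬ CSComplexity≤0 φ
  × HasShape φ × Exact1NormalForm φ

-- The counting operator
-- T_B(f_1..f_t) = E_{x_0∈B_0,...,x_q∈B_q} Π_i f_i(φ_i(x))
--             = (Σ_{x ∈ ℤ_M^{q+1}} Π_k 1_{B_k}(x_k) Π_i f_i(φ_i x)) / Π_k |B_k|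
T : ∀ {q t} (M : ℕ) .{{_ : NonZero M}} → LinMap q t →
    (Fin (suc q) → Bohr M) → (Fin t → Fin M → ℚ) → ℚ
T {q} {t} M φ Bs f =
  ΣVec M (suc q) (λ x → Πℚ (suc q) (λ k → 𝟙B M (Bs k) (lookup x k))
                        ℚ.* Πℚ t (λ i → f i (applyM M φ x i)))
  ℚ.* inv (Πℚ (suc q) (λ k → ℕ→ℚ (size M (Bs k))))

{-# OPTIONS --safe #-}
module Submission where

-- Write G = 1_A and H = α·1_{B₀}. Multilinearity telescopes T(G,…,G) - T(H,…,H) into the sum over i of
-- T(H,…,H, G - H, G,…,G), a tuple in which f_A = G - H occurs once. Since φᵢ(x₀, x) = x₀ + ψᵢ(x) and each
-- xₖ with k ≥ 1 lies in Bₖ ⊆ (B₀)_{|ρ}, every φᵢ(x) lies in B₀ as soon as x₀ lies in (B₀)_{|1-ρ'} for a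
-- suitable ρ' ≈ ρ·Σ|ψ|; by regularity that Bohr set contains half of B₀, so T(H,…,H) ≥ α^t/2. Hence if
-- T(1_A,…,1_A) < α^t/4 the t hybrid terms sum to less than -α^t/4, and one of them has absolute value at
-- least α^t/(4t).

open import Defs
open import Data.Nat as ℕ using (ℕ; zero; suc; NonZero; z≤n; s≤s; _∸_; _⊓_)
open import Data.Nat.Primality using (Prime)
import Data.Nat.Properties as ℕP
open import Data.Nat.DivMod using (m<n⇒m%n≡m)
import Data.Nat.Coprimality as Coprime
open import Data.Integer as ℤ using (ℤ; +_; -[1+_]; _⊖_)
import Data.Integer.Properties as ℤP
import Data.Integer.DivMod as ℤD
import Data.Integer.Tactic.RingSolver as ℤSolver
open import Data.Rational as ℚ using (ℚ; mkℚ; _+_; _*_; _-_; -_; _≤_; _<_; 0ℚ; 1ℚ; _÷_; _⊔_)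
import Data.Rational.Properties as ℚP
import Data.Rational.Unnormalised as ℚᵘ
import Data.Rational.Unnormalised.Properties as ℚᵘP
open import Data.Fin as Fin using (Fin; zero; suc; toℕ; inject₁)
import Data.Fin.Properties as FinP
open import Data.Fin.Subset using (Subset; _∈_; ∣_∣; inside; outside)
import Data.Fin.Subset.Properties as SubsetP
open import Data.Fin.Subset.Properties using (_∈?_)
open import Data.Vec using (Vec; []; _∷_; lookup; here; there)
open import Data.Bool using (Bool; true; false; if_then_else_)
import Data.Bool.Properties as BoolP
open import Data.Product using (Σ; ∃; _×_; _,_; proj₁; proj₂)
open import Data.Sum using (_⊎_; inj₁; inj₂)
open import Data.Empty using (⊥-elim)
open import Function using (_∘_)
open import Relation.Nullary using (¬_; Dec; yes; no; does)
open import Relation.Binary.PropositionalEquality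
open import Algebra.Bundles using (CommutativeRing)
open import Data.Rational.Solver using (module +-*-Solver)
open +-*-Solver using (solve; _:=_; _:+_; _:*_; _:-_; :-_; con)
import Algebra.Properties.Semiring.Sum

ℕ→ℚ≡mkℚ : ∀ n → ℕ→ℚ n ≡ mkℚ (+ n) 0 (Coprime.sym (Coprime.1-coprimeTo n))
ℕ→ℚ≡mkℚ n = ℚP.normalize-coprime (Coprime.sym (Coprime.1-coprimeTo n))

private
  toℚᵘ-ℕ→ℚ : ∀ n → ℚ.toℚᵘ (ℕ→ℚ n) ℚᵘ.≃ ℚᵘ.mkℚᵘ (+ n) 0
  toℚᵘ-ℕ→ℚ n = ℚᵘP.≃-reflexive (cong ℚ.toℚᵘ (ℕ→ℚ≡mkℚ n))

ℕ→ℚ-+ : ∀ a b → ℕ→ℚ (a ℕ.+ b) ≡ ℕ→ℚ a + ℕ→ℚ b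
ℕ→ℚ-+ a b = ℚP.toℚᵘ-injective (begin
  ℚ.toℚᵘ (ℕ→ℚ (a ℕ.+ b))                 ≈⟨ toℚᵘ-ℕ→ℚ (a ℕ.+ b) ⟩
  ℚᵘ.mkℚᵘ (+ (a ℕ.+ b)) 0                 ≈⟨ ℚᵘ.*≡* denominators-cleared ⟩
  ℚᵘ.mkℚᵘ (+ a) 0 ℚᵘ.+ ℚᵘ.mkℚᵘ (+ b) 0     ≈⟨ ℚᵘP.+-cong (toℚᵘ-ℕ→ℚ a) (toℚᵘ-ℕ→ℚ b) ⟨
  ℚ.toℚᵘ (ℕ→ℚ a) ℚᵘ.+ ℚ.toℚᵘ (ℕ→ℚ b)     ≈⟨ ℚP.toℚᵘ-homo-+ (ℕ→ℚ a) (ℕ→ℚ b) ⟨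
  ℚ.toℚᵘ (ℕ→ℚ a + ℕ→ℚ b)                 ∎)
  where
  open import Relation.Binary.Reasoning.Setoid ℚᵘP.≃-setoid
  denominators-cleared : + (a ℕ.+ b) ℤ.* + 1 ≡ (+ a ℤ.* + 1 ℤ.+ + b ℤ.* + 1) ℤ.* + 1
  denominators-cleared = trans (cong (ℤ._* + 1) (ℤP.pos-+ a b)) (clear (+ a) (+ b))
    where
    clear : ∀ x y → (x ℤ.+ y) ℤ.* + 1 ≡ (x ℤ.* + 1 ℤ.+ y ℤ.* + 1) ℤ.* + 1
    clear = ℤSolver.solve-∀

ℕ→ℚ-* : ∀ a b → ℕ→ℚ (a ℕ.* b) ≡ ℕ→ℚ a * ℕ→ℚ b
ℕ→ℚ-* a b = ℚP.toℚᵘ-injective (begin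
  ℚ.toℚᵘ (ℕ→ℚ (a ℕ.* b))                 ≈⟨ toℚᵘ-ℕ→ℚ (a ℕ.* b) ⟩
  ℚᵘ.mkℚᵘ (+ (a ℕ.* b)) 0                 ≈⟨ ℚᵘ.*≡* (cong (ℤ._* + 1) (ℤP.pos-* a b)) ⟩
  ℚᵘ.mkℚᵘ (+ a) 0 ℚᵘ.* ℚᵘ.mkℚᵘ (+ b) 0     ≈⟨ ℚᵘP.*-cong (toℚᵘ-ℕ→ℚ a) (toℚᵘ-ℕ→ℚ b) ⟨
  ℚ.toℚᵘ (ℕ→ℚ a) ℚᵘ.* ℚ.toℚᵘ (ℕ→ℚ b)     ≈⟨ ℚP.toℚᵘ-homo-* (ℕ→ℚ a) (ℕ→ℚ b) ⟨
  ℚ.toℚᵘ (ℕ→ℚ a * ℕ→ℚ b)                 ∎)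
  where open import Relation.Binary.Reasoning.Setoid ℚᵘP.≃-setoid

ℕ→ℚ-nonNeg : ∀ n → 0ℚ ≤ ℕ→ℚ n
ℕ→ℚ-nonNeg n rewrite ℕ→ℚ≡mkℚ n = ℚP.nonNegative⁻¹ _

ℕ→ℚ-pos : ∀ n → 0ℚ < ℕ→ℚ (suc n)
ℕ→ℚ-pos n rewrite ℕ→ℚ≡mkℚ (suc n) = ℚP.positive⁻¹ _

ℕ→ℚ-mono-≤ : ∀ {a b} → a ℕ.≤ b → ℕ→ℚ a ≤ ℕ→ℚ b
ℕ→ℚ-mono-≤ {a} a≤b with ℕP.m≤n⇒∃[o]m+o≡n a≤b
... | k , refl = begin
  ℕ→ℚ a          ≡⟨ ℚP.+-identityʳ (ℕ→ℚ a) ⟨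
  ℕ→ℚ a + 0ℚ     ≤⟨ ℚP.+-monoʳ-≤ (ℕ→ℚ a) (ℕ→ℚ-nonNeg k) ⟩
  ℕ→ℚ a + ℕ→ℚ k  ≡⟨ ℕ→ℚ-+ a k ⟨
  ℕ→ℚ (a ℕ.+ k)  ∎
  where open ℚP.≤-Reasoning

*-monoˡ-≤ : ∀ c {a b} → 0ℚ ≤ c → a ≤ b → c * a ≤ c * b
*-monoˡ-≤ c 0≤c = ℚP.*-monoˡ-≤-nonNeg c {{ℚ.nonNegative 0≤c}}

*-monoʳ-≤ : ∀ c {a b} → 0ℚ ≤ c → a ≤ b → a * c ≤ b * c
*-monoʳ-≤ c 0≤c = ℚP.*-monoʳ-≤-nonNeg c {{ℚ.nonNegative 0≤c}}

*-nonNeg : ∀ {a b} → 0ℚ ≤ a → 0ℚ ≤ b → 0ℚ ≤ a * b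
*-nonNeg {a} {b} 0≤a 0≤b = ℚP.nonNegative⁻¹ (a * b)
  {{ℚP.nonNeg*nonNeg⇒nonNeg a {{ℚ.nonNegative 0≤a}} b {{ℚ.nonNegative 0≤b}}}}

*-pos : ∀ {a b} → 0ℚ < a → 0ℚ < b → 0ℚ < a * b
*-pos {a} {b} 0<a 0<b = ℚP.positive⁻¹ (a * b)
  {{ℚP.pos*pos⇒pos a {{ℚ.positive 0<a}} b {{ℚ.positive 0<b}}}}

*-inv : ∀ {p} → 0ℚ < p → p * inv p ≡ 1ℚ
*-inv {mkℚ (+ zero) _ _} (ℚ.*<* (ℤ.+<+ ()))
*-inv {p@(mkℚ (+ suc _) _ _)} _ = ℚP.*-inverseʳ p

inv-pos : ∀ {p} → 0ℚ < p → 0ℚ < inv p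
inv-pos {mkℚ (+ zero) _ _} (ℚ.*<* (ℤ.+<+ ()))
inv-pos {p@(mkℚ (+ suc _) _ _)} _ = ℚP.positive⁻¹ _ {{ℚP.1/pos⇒pos p}}

1+-pos : ∀ {X} → 0ℚ ≤ X → 0ℚ < 1ℚ + X
1+-pos 0≤X = ℚP.+-mono-<-≤ (ℚP.positive⁻¹ 1ℚ) 0≤X

*-≤-inv-1+ : ∀ {X y} → 0ℚ ≤ X → 0ℚ ≤ y → y ≤ inv (1ℚ + X) → X * y ≤ 1ℚ
*-≤-inv-1+ {X} {y} 0≤X 0≤y y≤ = begin
  X * y                      ≡⟨ ℚP.+-identityˡ (X * y) ⟨
  0ℚ + X * y                 ≤⟨ ℚP.+-monoˡ-≤ (X * y) 0≤y ⟩
  y + X * y                  ≡⟨ factor X y ⟩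
  (1ℚ + X) * y               ≤⟨ *-monoˡ-≤ (1ℚ + X) (ℚP.<⇒≤ (1+-pos 0≤X)) y≤ ⟩
  (1ℚ + X) * inv (1ℚ + X)    ≡⟨ *-inv (1+-pos 0≤X) ⟩
  1ℚ                         ∎
  where
  open ℚP.≤-Reasoning
  factor : ∀ X y → y + X * y ≡ (1ℚ + X) * y
  factor = solve 2 (λ X y → y :+ X :* y := (con 1ℚ :+ X) :* y) refl

inv-1+-≤1 : ∀ {X} → 0ℚ ≤ X → inv (1ℚ + X) ≤ 1ℚ
inv-1+-≤1 {X} 0≤X = begin
  inv (1ℚ + X)               ≡⟨ ℚP.*-identityˡ _ ⟨
  1ℚ * inv (1ℚ + X)          ≤⟨ *-monoʳ-≤ _ (ℚP.<⇒≤ (inv-pos (1+-pos 0≤X))) 1≤1+X ⟩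
  (1ℚ + X) * inv (1ℚ + X)    ≡⟨ *-inv (1+-pos 0≤X) ⟩
  1ℚ                         ∎
  where
  open ℚP.≤-Reasoning
  1≤1+X : 1ℚ ≤ 1ℚ + X
  1≤1+X = ℚP.≤-trans (ℚP.≤-reflexive (sym (ℚP.+-identityʳ 1ℚ))) (ℚP.+-monoʳ-≤ 1ℚ 0≤X)

module ℚΣ = Algebra.Properties.Semiring.Sum (CommutativeRing.semiring ℚP.+-*-commutativeRing)

Σℚ≡sum : ∀ n (f : Fin n → ℚ) → Σℚ n f ≡ ℚΣ.sum f
Σℚ≡sum zero    f = refl
Σℚ≡sum (suc n) f = cong (_+_ (f zero)) (Σℚ≡sum n (f ∘ suc))

Σℚ-cong : ∀ n {f g : Fin n → ℚ} → (∀ i → f i ≡ g i) → Σℚ n f ≡ Σℚ n g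
Σℚ-cong zero    f≗g = refl
Σℚ-cong (suc n) f≗g = cong₂ _+_ (f≗g zero) (Σℚ-cong n (f≗g ∘ suc))

Σℚ-distrib-+ : ∀ n (f g : Fin n → ℚ) → Σℚ n (λ i → f i + g i) ≡ Σℚ n f + Σℚ n g
Σℚ-distrib-+ n f g rewrite Σℚ≡sum n (λ i → f i + g i) | Σℚ≡sum n f | Σℚ≡sum n g = ℚΣ.∑-distrib-+ f g

Σℚ-comm : ∀ m n (f : Fin m → Fin n → ℚ) → Σℚ m (λ a → Σℚ n (f a)) ≡ Σℚ n (λ i → Σℚ m (λ a → f a i))
Σℚ-comm m n f = begin
  Σℚ m (λ a → Σℚ n (f a))            ≡⟨ Σℚ-cong m (λ a → Σℚ≡sum n (f a)) ⟩
  Σℚ m (λ a → ℚΣ.sum (f a))          ≡⟨ Σℚ≡sum m _ ⟩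
  ℚΣ.sum (λ a → ℚΣ.sum (f a))        ≡⟨ ℚΣ.∑-comm f ⟩
  ℚΣ.sum (λ i → ℚΣ.sum (λ a → f a i)) ≡⟨ Σℚ≡sum n _ ⟨
  Σℚ n (λ i → ℚΣ.sum (λ a → f a i))  ≡⟨ Σℚ-cong n (λ i → Σℚ≡sum m (λ a → f a i)) ⟨
  Σℚ n (λ i → Σℚ m (λ a → f a i))    ∎
  where open ≡-Reasoning

Σℚ-*ˡ : ∀ n a (f : Fin n → ℚ) → Σℚ n (λ i → a * f i) ≡ a * Σℚ n f
Σℚ-*ˡ n a f rewrite Σℚ≡sum n (λ i → a * f i) | Σℚ≡sum n f = sym (ℚΣ.*-distribˡ-sum a f)

Σℚ-*ʳ : ∀ n a (f : Fin n → ℚ) → Σℚ n (λ i → f i * a) ≡ Σℚ n f * a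
Σℚ-*ʳ n a f rewrite Σℚ≡sum n (λ i → f i * a) | Σℚ≡sum n f = sym (ℚΣ.*-distribʳ-sum a f)

Σℚ-const : ∀ n b → Σℚ n (λ _ → b) ≡ ℕ→ℚ n * b
Σℚ-const zero    b = sym (ℚP.*-zeroˡ b)
Σℚ-const (suc n) b = begin
  b + Σℚ n (λ _ → b)        ≡⟨ cong (_+_ b) (Σℚ-const n b) ⟩
  b + ℕ→ℚ n * b             ≡⟨ factor b (ℕ→ℚ n) ⟩
  (1ℚ + ℕ→ℚ n) * b          ≡⟨ cong (_* b) (ℕ→ℚ-+ 1 n) ⟨
  ℕ→ℚ (suc n) * b           ∎
  where
  open ≡-Reasoning
  factor : ∀ b x → b + x * b ≡ (1ℚ + x) * b
  factor = solve 2 (λ b x → b :+ x :* b := (con 1ℚ :+ x) :* b) refl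

Σℚ-mono-≤ : ∀ n {f g : Fin n → ℚ} → (∀ i → f i ≤ g i) → Σℚ n f ≤ Σℚ n g
Σℚ-mono-≤ zero    f≤g = ℚP.≤-refl
Σℚ-mono-≤ (suc n) f≤g = ℚP.+-mono-≤ (f≤g zero) (Σℚ-mono-≤ n (f≤g ∘ suc))

Σℚ-nonNeg : ∀ n {f : Fin n → ℚ} → (∀ i → 0ℚ ≤ f i) → 0ℚ ≤ Σℚ n f
Σℚ-nonNeg zero    0≤f = ℚP.≤-refl
Σℚ-nonNeg (suc n) 0≤f = ℚP.+-mono-≤ (0≤f zero) (Σℚ-nonNeg n (0≤f ∘ suc))

term≤Σℚ : ∀ n {f : Fin n → ℚ} → (∀ i → 0ℚ ≤ f i) → ∀ i → f i ≤ Σℚ n f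
term≤Σℚ (suc n) {f} 0≤f zero = begin
  f zero             ≡⟨ ℚP.+-identityʳ (f zero) ⟨
  f zero + 0ℚ        ≤⟨ ℚP.+-monoʳ-≤ (f zero) (Σℚ-nonNeg n (0≤f ∘ suc)) ⟩
  Σℚ (suc n) f       ∎
  where open ℚP.≤-Reasoning
term≤Σℚ (suc n) {f} 0≤f (suc i) = begin
  f (suc i)                  ≤⟨ term≤Σℚ n (0≤f ∘ suc) i ⟩
  Σℚ n (f ∘ suc)             ≡⟨ ℚP.+-identityˡ _ ⟨
  0ℚ + Σℚ n (f ∘ suc)        ≤⟨ ℚP.+-monoˡ-≤ _ (0≤f zero) ⟩
  Σℚ (suc n) f               ∎
  where open ℚP.≤-Reasoning

Σℚ-<-const : ∀ n (g : Fin n → ℚ) b → Σℚ n g < Σℚ n (λ _ → b) → ∃ λ i → g i < b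
Σℚ-<-const n g b Σg<Σb with FinP.any? (λ i → g i ℚP.<? b)
... | yes found = found
... | no  none  = ⊥-elim (ℚP.<-irrefl refl (ℚP.<-≤-trans Σg<Σb Σb≤Σg))
  where
  Σb≤Σg : Σℚ n (λ _ → b) ≤ Σℚ n g
  Σb≤Σg = Σℚ-mono-≤ n (λ i → ℚP.≮⇒≥ (λ gᵢ<b → none (i , gᵢ<b)))

Πℚ-cong : ∀ n {f g : Fin n → ℚ} → (∀ i → f i ≡ g i) → Πℚ n f ≡ Πℚ n g
Πℚ-cong zero    f≗g = refl
Πℚ-cong (suc n) f≗g = cong₂ _*_ (f≗g zero) (Πℚ-cong n (f≗g ∘ suc))

Πℚ-zero : ∀ n (f : Fin n → ℚ) i → f i ≡ 0ℚ → Πℚ n f ≡ 0ℚ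
Πℚ-zero (suc n) f zero    fᵢ≡0 = trans (cong (_* Πℚ n (f ∘ suc)) fᵢ≡0) (ℚP.*-zeroˡ (Πℚ n (f ∘ suc)))
Πℚ-zero (suc n) f (suc i) fᵢ≡0 = trans (cong (_*_ (f zero)) (Πℚ-zero n (f ∘ suc) i fᵢ≡0)) (ℚP.*-zeroʳ (f zero))

Πℚ-const : ∀ n (f : Fin n → ℚ) a → (∀ i → f i ≡ a) → Πℚ n f ≡ a ^ℚ n
Πℚ-const zero    f a f≡a = refl
Πℚ-const (suc n) f a f≡a = cong₂ _*_ (f≡a zero) (Πℚ-const n (f ∘ suc) a (f≡a ∘ suc))

Πℚ-one : ∀ n (f : Fin n → ℚ) → (∀ i → f i ≡ 1ℚ) → Πℚ n f ≡ 1ℚ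
Πℚ-one zero    f f≡1 = refl
Πℚ-one (suc n) f f≡1 = cong₂ _*_ (f≡1 zero) (Πℚ-one n (f ∘ suc) (f≡1 ∘ suc))

Πℚ-nonNeg : ∀ n {f : Fin n → ℚ} → (∀ i → 0ℚ ≤ f i) → 0ℚ ≤ Πℚ n f
Πℚ-nonNeg zero    0≤f = ℚP.nonNegative⁻¹ 1ℚ
Πℚ-nonNeg (suc n) 0≤f = *-nonNeg (0≤f zero) (Πℚ-nonNeg n (0≤f ∘ suc))

Πℚ-pos : ∀ n {f : Fin n → ℚ} → (∀ i → 0ℚ < f i) → 0ℚ < Πℚ n f
Πℚ-pos zero    0<f = ℚP.positive⁻¹ 1ℚ
Πℚ-pos (suc n) 0<f = *-pos (0<f zero) (Πℚ-pos n (0<f ∘ suc))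

^ℚ-nonNeg : ∀ {a} n → 0ℚ ≤ a → 0ℚ ≤ a ^ℚ n
^ℚ-nonNeg zero    0≤a = ℚP.nonNegative⁻¹ 1ℚ
^ℚ-nonNeg (suc n) 0≤a = *-nonNeg 0≤a (^ℚ-nonNeg n 0≤a)

module _ (M : ℕ) where

  ΣVec-cong : ∀ n {f g : Vec (Fin M) n → ℚ} → (∀ x → f x ≡ g x) → ΣVec M n f ≡ ΣVec M n g
  ΣVec-cong zero    f≗g = f≗g []
  ΣVec-cong (suc n) f≗g = Σℚ-cong M (λ a → ΣVec-cong n (λ xs → f≗g (a ∷ xs)))

  ΣVec-distrib-+ : ∀ n (f g : Vec (Fin M) n → ℚ) → ΣVec M n (λ x → f x + g x) ≡ ΣVec M n f + ΣVec M n g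
  ΣVec-distrib-+ zero    f g = refl
  ΣVec-distrib-+ (suc n) f g = trans (Σℚ-cong M (λ a → ΣVec-distrib-+ n _ _)) (Σℚ-distrib-+ M _ _)

  ΣVec-*ˡ : ∀ n a (f : Vec (Fin M) n → ℚ) → ΣVec M n (λ x → a * f x) ≡ a * ΣVec M n f
  ΣVec-*ˡ zero    a f = refl
  ΣVec-*ˡ (suc n) a f = trans (Σℚ-cong M (λ b → ΣVec-*ˡ n a _)) (Σℚ-*ˡ M a _)

  ΣVec-mono-≤ : ∀ n {f g : Vec (Fin M) n → ℚ} → (∀ x → f x ≤ g x) → ΣVec M n f ≤ ΣVec M n g
  ΣVec-mono-≤ zero    f≤g = f≤g []
  ΣVec-mono-≤ (suc n) f≤g = Σℚ-mono-≤ M (λ a → ΣVec-mono-≤ n (λ xs → f≤g (a ∷ xs)))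

  ΣVec-Σℚ : ∀ n t (f : Fin t → Vec (Fin M) n → ℚ) →
    ΣVec M n (λ x → Σℚ t (λ i → f i x)) ≡ Σℚ t (λ i → ΣVec M n (f i))
  ΣVec-Σℚ zero    t f = refl
  ΣVec-Σℚ (suc n) t f = trans (Σℚ-cong M (λ a → ΣVec-Σℚ n t (λ i xs → f i (a ∷ xs))))
                              (Σℚ-comm M t (λ a i → ΣVec M n (λ xs → f i (a ∷ xs))))

  ΣVec-Πℚ : ∀ n (g : Fin n → Fin M → ℚ) →
    ΣVec M n (λ x → Πℚ n (λ k → g k (lookup x k))) ≡ Πℚ n (λ k → Σℚ M (g k))
  ΣVec-Πℚ zero    g = refl
  ΣVec-Πℚ (suc n) g = begin
    Σℚ M (λ a → ΣVec M n (λ xs → g zero a * Πℚ n (λ k → g (suc k) (lookup xs k))))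
      ≡⟨ Σℚ-cong M (λ a → ΣVec-*ˡ n (g zero a) _) ⟩
    Σℚ M (λ a → g zero a * ΣVec M n (λ xs → Πℚ n (λ k → g (suc k) (lookup xs k))))
      ≡⟨ Σℚ-cong M (λ a → cong (_*_ (g zero a)) (ΣVec-Πℚ n (g ∘ suc))) ⟩
    Σℚ M (λ a → g zero a * Πℚ n (λ k → Σℚ M (g (suc k))))
      ≡⟨ Σℚ-*ʳ M _ (g zero) ⟩
    Σℚ M (g zero) * Πℚ n (λ k → Σℚ M (g (suc k)))
      ∎
    where open ≡-Reasoning

Σℤ-cong : ∀ n {f g : Fin n → ℤ} → (∀ i → f i ≡ g i) → Σℤ n f ≡ Σℤ n g
Σℤ-cong zero    f≗g = refl
Σℤ-cong (suc n) f≗g = cong₂ ℤ._+_ (f≗g zero) (Σℤ-cong n (f≗g ∘ suc))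

Σℤ-*ʳ : ∀ n (f : Fin n → ℤ) w → Σℤ n f ℤ.* w ≡ Σℤ n (λ i → f i ℤ.* w)
Σℤ-*ʳ zero    f w = refl
Σℤ-*ʳ (suc n) f w = trans (ℤP.*-distribʳ-+ w (f zero) (Σℤ n (f ∘ suc)))
                          (cong (ℤ._+_ (f zero ℤ.* w)) (Σℤ-*ʳ n (f ∘ suc) w))

module _ (m : ℕ) where

  private
    M : ℕ
    M = suc m

  -- ‖ mulM M x r /M‖ is by definition (+ dist (+ (toℕ x ℕ.* toℕ r))) ℚ./ M.
  dist : ℤ → ℕ
  dist z = toℕ (reduce M z) ⊓ (M ∸ toℕ (reduce M z))

  reduce-decomposition : ∀ z → z ≡ + toℕ (reduce M z) ℤ.+ (z ℤ./ℕ M) ℤ.* + M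
  reduce-decomposition z = trans (ℤD.a≡a%ℕn+[a/ℕn]*n z M)
    (cong (λ r → + r ℤ.+ (z ℤ./ℕ M) ℤ.* + M) (sym toℕ-reduce))
    where
    toℕ-reduce : toℕ (reduce M z) ≡ z ℤ.%ℕ M
    toℕ-reduce = trans (FinP.toℕ-fromℕ< _) (m<n⇒m%n≡m (ℤD.n%ℕd<d z M))

  ⊓-∸-≤-∣+*∣ : ∀ {r} → r ℕ.< M → ∀ e → r ⊓ (M ∸ r) ℕ.≤ ℤ.∣ + r ℤ.+ e ℤ.* + M ∣
  ⊓-∸-≤-∣+*∣ {r} r<M (+ n) rewrite sym (ℤP.pos-* n M) | sym (ℤP.pos-+ r (n ℕ.* M)) =
    ℕP.≤-trans (ℕP.m⊓n≤m r (M ∸ r)) (ℕP.m≤m+n r (n ℕ.* M))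
  ⊓-∸-≤-∣+*∣ {r} r<M -[1+ n ] = ℕP.≤-trans (ℕP.m⊓n≤n r (M ∸ r)) (begin
    M ∸ r                          ≤⟨ ℕP.∸-monoˡ-≤ r (ℕP.m≤m+n M (n ℕ.* M)) ⟩
    suc n ℕ.* M ∸ r                ≡⟨ ℤP.∣⊖∣-< r<[1+n]M ⟨
    ℤ.∣ r ⊖ suc n ℕ.* M ∣          ≡⟨ cong ℤ.∣_∣ (ℤP.m-n≡m⊖n r (suc n ℕ.* M)) ⟨
    ℤ.∣ + r ℤ.- + (suc n ℕ.* M) ∣  ≡⟨ cong (λ w → ℤ.∣ + r ℤ.+ ℤ.- w ∣) (ℤP.pos-* (suc n) M) ⟩
    ℤ.∣ + r ℤ.+ ℤ.- (+ suc n ℤ.* + M) ∣ ≡⟨ cong (λ w → ℤ.∣ + r ℤ.+ w ∣) (ℤP.neg-distribˡ-* (+ suc n) (+ M)) ⟩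
    ℤ.∣ + r ℤ.+ -[1+ n ] ℤ.* + M ∣ ∎)
    where
    open ℕP.≤-Reasoning
    r<[1+n]M : r ℕ.< suc n ℕ.* M
    r<[1+n]M = ℕP.<-≤-trans r<M (ℕP.m≤m+n M (n ℕ.* M))

  dist-≤ : ∀ z e → dist z ℕ.≤ ℤ.∣ z ℤ.+ e ℤ.* + M ∣
  dist-≤ z e = subst (λ w → dist z ℕ.≤ ℤ.∣ w ∣) (sym shift)
                     (⊓-∸-≤-∣+*∣ (FinP.toℕ<n (reduce M z)) (z ℤ./ℕ M ℤ.+ e))
    where
    regroup : ∀ a b c d → a ℤ.+ b ℤ.* d ℤ.+ c ℤ.* d ≡ a ℤ.+ (b ℤ.+ c) ℤ.* d
    regroup = ℤSolver.solve-∀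
    shift : z ℤ.+ e ℤ.* + M ≡ + toℕ (reduce M z) ℤ.+ (z ℤ./ℕ M ℤ.+ e) ℤ.* + M
    shift = trans (cong (ℤ._+ e ℤ.* + M) (reduce-decomposition z))
                  (regroup (+ toℕ (reduce M z)) (z ℤ./ℕ M) e (+ M))

  dist-attained : ∀ z → ∃ λ e → dist z ≡ ℤ.∣ z ℤ.+ e ℤ.* + M ∣
  dist-attained z = attained (ℕP.≤-total r (M ∸ r))
    where
    open ≡-Reasoning
    r = toℕ (reduce M z)
    j = z ℤ./ℕ M
    cancel : ∀ a b d → a ℤ.+ b ℤ.* d ℤ.+ ℤ.- b ℤ.* d ≡ a
    cancel = ℤSolver.solve-∀
    cancel-one-more : ∀ a b d → a ℤ.+ b ℤ.* d ℤ.+ ℤ.- (b ℤ.+ + 1) ℤ.* d ≡ a ℤ.- d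
    cancel-one-more = ℤSolver.solve-∀
    attained : r ℕ.≤ M ∸ r ⊎ M ∸ r ℕ.≤ r → ∃ λ e → dist z ≡ ℤ.∣ z ℤ.+ e ℤ.* + M ∣
    attained (inj₁ r≤M-r) = ℤ.- j , (begin
      dist z                                    ≡⟨ ℕP.m≤n⇒m⊓n≡m r≤M-r ⟩
      ℤ.∣ + r ∣                                 ≡⟨ cong ℤ.∣_∣ (cancel (+ r) j (+ M)) ⟨
      ℤ.∣ + r ℤ.+ j ℤ.* + M ℤ.+ ℤ.- j ℤ.* + M ∣ ≡⟨ cong (λ w → ℤ.∣ w ℤ.+ ℤ.- j ℤ.* + M ∣) (reduce-decomposition z) ⟨
      ℤ.∣ z ℤ.+ ℤ.- j ℤ.* + M ∣                 ∎)
    attained (inj₂ M-r≤r) = ℤ.- (j ℤ.+ + 1) , (begin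
      dist z                              ≡⟨ ℕP.m≥n⇒m⊓n≡n M-r≤r ⟩
      M ∸ r                               ≡⟨ ℤP.∣⊖∣-< (FinP.toℕ<n (reduce M z)) ⟨
      ℤ.∣ r ⊖ M ∣                         ≡⟨ cong ℤ.∣_∣ (ℤP.m-n≡m⊖n r M) ⟨
      ℤ.∣ + r ℤ.- + M ∣                   ≡⟨ cong ℤ.∣_∣ (cancel-one-more (+ r) j (+ M)) ⟨
      ℤ.∣ + r ℤ.+ j ℤ.* + M ℤ.+ ℤ.- (j ℤ.+ + 1) ℤ.* + M ∣
        ≡⟨ cong (λ w → ℤ.∣ w ℤ.+ ℤ.- (j ℤ.+ + 1) ℤ.* + M ∣) (reduce-decomposition z) ⟨
      ℤ.∣ z ℤ.+ ℤ.- (j ℤ.+ + 1) ℤ.* + M ∣ ∎)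

  dist-+-≤ : ∀ z w → dist (z ℤ.+ w) ℕ.≤ dist z ℕ.+ dist w
  dist-+-≤ z w with dist-attained z | dist-attained w
  ... | e , dz≡ | f , dw≡ = begin
    dist (z ℤ.+ w)                                       ≤⟨ dist-≤ (z ℤ.+ w) (e ℤ.+ f) ⟩
    ℤ.∣ z ℤ.+ w ℤ.+ (e ℤ.+ f) ℤ.* + M ∣                  ≡⟨ cong ℤ.∣_∣ (regroup z w e f (+ M)) ⟩
    ℤ.∣ (z ℤ.+ e ℤ.* + M) ℤ.+ (w ℤ.+ f ℤ.* + M) ∣        ≤⟨ ℤP.∣i+j∣≤∣i∣+∣j∣ (z ℤ.+ e ℤ.* + M) (w ℤ.+ f ℤ.* + M) ⟩
    ℤ.∣ z ℤ.+ e ℤ.* + M ∣ ℕ.+ ℤ.∣ w ℤ.+ f ℤ.* + M ∣      ≡⟨ cong₂ ℕ._+_ dz≡ dw≡ ⟨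
    dist z ℕ.+ dist w                                    ∎
    where
    open ℕP.≤-Reasoning
    regroup : ∀ z w e f d → z ℤ.+ w ℤ.+ (e ℤ.+ f) ℤ.* d ≡ (z ℤ.+ e ℤ.* d) ℤ.+ (w ℤ.+ f ℤ.* d)
    regroup = ℤSolver.solve-∀

  dist-*-≤ : ∀ c z → dist (c ℤ.* z) ℕ.≤ ℤ.∣ c ∣ ℕ.* dist z
  dist-*-≤ c z with dist-attained z
  ... | e , dz≡ = begin
    dist (c ℤ.* z)                            ≤⟨ dist-≤ (c ℤ.* z) (c ℤ.* e) ⟩
    ℤ.∣ c ℤ.* z ℤ.+ c ℤ.* e ℤ.* + M ∣         ≡⟨ cong ℤ.∣_∣ (factor c z e (+ M)) ⟩
    ℤ.∣ c ℤ.* (z ℤ.+ e ℤ.* + M) ∣             ≡⟨ ℤP.abs-* c _ ⟩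
    ℤ.∣ c ∣ ℕ.* ℤ.∣ z ℤ.+ e ℤ.* + M ∣         ≡⟨ cong (ℤ.∣ c ∣ ℕ.*_) dz≡ ⟨
    ℤ.∣ c ∣ ℕ.* dist z                        ∎
    where
    open ℕP.≤-Reasoning
    factor : ∀ c z e d → c ℤ.* z ℤ.+ c ℤ.* e ℤ.* d ≡ c ℤ.* (z ℤ.+ e ℤ.* d)
    factor = ℤSolver.solve-∀

  dist-periodic : ∀ z k → dist (z ℤ.+ k ℤ.* + M) ℕ.≤ dist z
  dist-periodic z k with dist-attained z
  ... | e , dz≡ = begin
    dist (z ℤ.+ k ℤ.* + M)                              ≤⟨ dist-≤ (z ℤ.+ k ℤ.* + M) (e ℤ.- k) ⟩
    ℤ.∣ z ℤ.+ k ℤ.* + M ℤ.+ (e ℤ.- k) ℤ.* + M ∣         ≡⟨ cong ℤ.∣_∣ (cancel z k e (+ M)) ⟩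
    ℤ.∣ z ℤ.+ e ℤ.* + M ∣                               ≡⟨ dz≡ ⟨
    dist z                                              ∎
    where
    open ℕP.≤-Reasoning
    cancel : ∀ z k e d → z ℤ.+ k ℤ.* d ℤ.+ (e ℤ.- k) ℤ.* d ≡ z ℤ.+ e ℤ.* d
    cancel = ℤSolver.solve-∀

  dist-reduce-* : ∀ z w → dist (+ toℕ (reduce M z) ℤ.* w) ℕ.≤ dist (z ℤ.* w)
  dist-reduce-* z w = subst (λ v → dist v ℕ.≤ dist (z ℤ.* w)) (sym unreduce)
                            (dist-periodic (z ℤ.* w) (ℤ.- (j ℤ.* w)))
    where
    j = z ℤ./ℕ M
    shift : ∀ r j d w → (r ℤ.+ j ℤ.* d) ℤ.* w ℤ.+ ℤ.- (j ℤ.* w) ℤ.* d ≡ r ℤ.* w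
    shift = ℤSolver.solve-∀
    unreduce : + toℕ (reduce M z) ℤ.* w ≡ z ℤ.* w ℤ.+ ℤ.- (j ℤ.* w) ℤ.* + M
    unreduce = trans (sym (shift (+ toℕ (reduce M z)) j (+ M) w))
                     (cong (λ v → v ℤ.* w ℤ.+ ℤ.- (j ℤ.* w) ℤ.* + M) (sym (reduce-decomposition z)))

  dist-Σ-≤ : ∀ n (c y : Fin n → ℤ) →
    ℕ→ℚ (dist (Σℤ n (λ k → c k ℤ.* y k))) ≤ Σℚ n (λ k → ℕ→ℚ ℤ.∣ c k ∣ * ℕ→ℚ (dist (y k)))
  dist-Σ-≤ zero    c y = ℚP.≤-refl
  dist-Σ-≤ (suc n) c y = begin
    ℕ→ℚ (dist (c₀y₀ ℤ.+ S))                   ≤⟨ ℕ→ℚ-mono-≤ (dist-+-≤ c₀y₀ S) ⟩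
    ℕ→ℚ (dist c₀y₀ ℕ.+ dist S)                ≡⟨ ℕ→ℚ-+ (dist c₀y₀) (dist S) ⟩
    ℕ→ℚ (dist c₀y₀) + ℕ→ℚ (dist S)            ≤⟨ ℚP.+-mono-≤ (ℕ→ℚ-mono-≤ (dist-*-≤ (c zero) (y zero)))
                                                              (dist-Σ-≤ n (c ∘ suc) (y ∘ suc)) ⟩
    ℕ→ℚ (ℤ.∣ c zero ∣ ℕ.* dist (y zero)) + ΣS  ≡⟨ cong (_+ ΣS) (ℕ→ℚ-* ℤ.∣ c zero ∣ (dist (y zero))) ⟩
    Σℚ (suc n) (λ k → ℕ→ℚ ℤ.∣ c k ∣ * ℕ→ℚ (dist (y k)))    ∎
    where
    open ℚP.≤-Reasoning
    c₀y₀ = c zero ℤ.* y zero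
    S = Σℤ n (λ k → c (suc k) ℤ.* y (suc k))
    ΣS = Σℚ n (λ k → ℕ→ℚ ℤ.∣ c (suc k) ∣ * ℕ→ℚ (dist (y (suc k))))

  /M-linear : ∀ n → (+ n) ℚ./ M ≡ ℕ→ℚ n * ((+ 1) ℚ./ M)
  /M-linear n = ℚP.toℚᵘ-injective (begin
    ℚ.toℚᵘ ((+ n) ℚ./ M)                          ≈⟨ ℚP.toℚᵘ-fromℚᵘ (ℚᵘ.mkℚᵘ (+ n) m) ⟩
    ℚᵘ.mkℚᵘ (+ n) m                               ≈⟨ ℚᵘ.*≡* denominators-cleared ⟩
    ℚᵘ.mkℚᵘ (+ n) 0 ℚᵘ.* ℚᵘ.mkℚᵘ (+ 1) m           ≈⟨ ℚᵘP.*-cong (toℚᵘ-ℕ→ℚ n) (ℚP.toℚᵘ-fromℚᵘ (ℚᵘ.mkℚᵘ (+ 1) m)) ⟨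
    ℚ.toℚᵘ (ℕ→ℚ n) ℚᵘ.* ℚ.toℚᵘ ((+ 1) ℚ./ M)      ≈⟨ ℚP.toℚᵘ-homo-* (ℕ→ℚ n) _ ⟨
    ℚ.toℚᵘ (ℕ→ℚ n * ((+ 1) ℚ./ M))                ∎)
    where
    open import Relation.Binary.Reasoning.Setoid ℚᵘP.≃-setoid
    denominators-cleared : + n ℤ.* + suc (m ℕ.+ 0) ≡ + n ℤ.* + 1 ℤ.* + M
    denominators-cleared rewrite ℕP.+-identityʳ m | ℤP.*-identityʳ (+ n) = refl

  ‖mulM‖≡ : ∀ x r → ‖_/M‖ M (mulM M x r) ≡ ℕ→ℚ (dist (+ toℕ x ℤ.* + toℕ r)) * ((+ 1) ℚ./ M)
  ‖mulM‖≡ x r = trans (/M-linear (dist (+ (toℕ x ℕ.* toℕ r)))) (cong (λ v → ℕ→ℚ (dist v) * ((+ 1) ℚ./ M)) (ℤP.pos-* (toℕ x) (toℕ r)))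

  ‖applyM‖-≤ : ∀ {q t} (φ : LinMap q t) x i r →
    ‖_/M‖ M (mulM M (applyM M φ x i) r) ≤ Σℚ (suc q) (λ k → ℕ→ℚ ℤ.∣ φ i k ∣ * ‖_/M‖ M (mulM M (lookup x k) r))
  ‖applyM‖-≤ {q} φ x i r = begin
    ‖_/M‖ M (mulM M (applyM M φ x i) r)
      ≡⟨ ‖mulM‖≡ (applyM M φ x i) r ⟩
    ℕ→ℚ (dist (+ toℕ (reduce M Z) ℤ.* ρ)) * u
      ≤⟨ *-monoʳ-≤ u 0≤u (ℕ→ℚ-mono-≤ (dist-reduce-* Z ρ)) ⟩
    ℕ→ℚ (dist (Z ℤ.* ρ)) * u
      ≡⟨ cong (λ v → ℕ→ℚ (dist v) * u) Zρ≡ ⟩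
    ℕ→ℚ (dist (Σℤ (suc q) (λ k → φ i k ℤ.* (xₖ k ℤ.* ρ)))) * u
      ≤⟨ *-monoʳ-≤ u 0≤u (dist-Σ-≤ (suc q) (φ i) (λ k → xₖ k ℤ.* ρ)) ⟩
    Σℚ (suc q) (λ k → ℕ→ℚ ℤ.∣ φ i k ∣ * ℕ→ℚ (dist (xₖ k ℤ.* ρ))) * u
      ≡⟨ Σℚ-*ʳ (suc q) u (λ k → ℕ→ℚ ℤ.∣ φ i k ∣ * ℕ→ℚ (dist (xₖ k ℤ.* ρ))) ⟨
    Σℚ (suc q) (λ k → ℕ→ℚ ℤ.∣ φ i k ∣ * ℕ→ℚ (dist (xₖ k ℤ.* ρ)) * u)
      ≡⟨ Σℚ-cong (suc q) (λ k → trans (ℚP.*-assoc (ℕ→ℚ ℤ.∣ φ i k ∣) (ℕ→ℚ (dist (xₖ k ℤ.* ρ))) u) (cong (_*_ (ℕ→ℚ ℤ.∣ φ i k ∣)) (sym (‖mulM‖≡ (lookup x k) r)))) ⟩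
    Σℚ (suc q) (λ k → ℕ→ℚ ℤ.∣ φ i k ∣ * ‖_/M‖ M (mulM M (lookup x k) r))
      ∎
    where
    open ℚP.≤-Reasoning
    u = (+ 1) ℚ./ M
    0≤u : 0ℚ ≤ u
    0≤u = ℚP.nonNegative⁻¹ u {{ℚP.normalize-nonNeg 1 M}}
    ρ = + toℕ r
    xₖ : Fin (suc q) → ℤ
    xₖ k = + toℕ (lookup x k)
    Z = Σℤ (suc q) (λ k → φ i k ℤ.* xₖ k)
    Zρ≡ : Z ℤ.* ρ ≡ Σℤ (suc q) (λ k → φ i k ℤ.* (xₖ k ℤ.* ρ))
    Zρ≡ = trans (Σℤ-*ʳ (suc q) (λ k → φ i k ℤ.* xₖ k) ρ) (Σℤ-cong (suc q) (λ k → ℤP.*-assoc (φ i k) (xₖ k) ρ))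

allFinB⇒∀ : ∀ n (p : Fin n → Bool) → allFinB n p ≡ true → ∀ i → p i ≡ true
allFinB⇒∀ (suc n) p all i with p zero in p₀
allFinB⇒∀ (suc n) p all zero    | true = p₀
allFinB⇒∀ (suc n) p all (suc i) | true = allFinB⇒∀ n (p ∘ suc) all i
allFinB⇒∀ (suc n) p ()  i       | false

∀⇒allFinB : ∀ n (p : Fin n → Bool) → (∀ i → p i ≡ true) → allFinB n p ≡ true
∀⇒allFinB zero    p all = refl
∀⇒allFinB (suc n) p all rewrite all zero = ∀⇒allFinB n (p ∘ suc) (all ∘ suc)

if-does⇒ : ∀ {A B : Set} (a? : Dec A) (b? : Dec B) → (if does a? then does b? else true) ≡ true → A → B
if-does⇒ (yes a) (yes b) _  _ = b
if-does⇒ (no ¬a) b?      _  a = ⊥-elim (¬a a)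

⇒if-does : ∀ {A B : Set} (a? : Dec A) (b? : Dec B) → (A → B) → (if does a? then does b? else true) ≡ true
⇒if-does (yes a) (yes b) _   = refl
⇒if-does (yes a) (no ¬b) a→b = ⊥-elim (¬b (a→b a))
⇒if-does (no ¬a) b?      _   = refl

module _ (m : ℕ) where

  private
    M : ℕ
    M = suc m

    frequencyTest : Bohr M → Fin M → Fin M → Bool
    frequencyTest B x r = if does (r ∈? freq B) then does (‖_/M‖ M (mulM M x r) ℚP.≤? radius B) else true

  ∈B⇒ : ∀ B x → _∈B_ M x B → ∀ r → r ∈ freq B → ‖_/M‖ M (mulM M x r) ≤ radius B
  ∈B⇒ B x x∈B r = if-does⇒ (r ∈? freq B) (‖_/M‖ M (mulM M x r) ℚP.≤? radius B)
                           (allFinB⇒∀ M (frequencyTest B x) x∈B r)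

  ⇒∈B : ∀ B x → (∀ r → r ∈ freq B → ‖_/M‖ M (mulM M x r) ≤ radius B) → _∈B_ M x B
  ⇒∈B B x close = ∀⇒allFinB M (frequencyTest B x)
                    (λ r → ⇒if-does (r ∈? freq B) (‖_/M‖ M (mulM M x r) ℚP.≤? radius B) (close r))

  0∈B : ∀ B → 0ℚ ≤ radius B → _∈B_ M zero B
  0∈B B 0≤δ = ⇒∈B B zero (λ _ _ → ℚP.≤-trans (ℚP.≤-reflexive (ℚP.0/n≡0 M)) 0≤δ)

  ∈B-dilate-≤1 : ∀ B {ρ} x → 0ℚ ≤ radius B → ρ ≤ 1ℚ → _∈B_ M x (_∣_ M B ρ) → _∈B_ M x B
  ∈B-dilate-≤1 B {ρ} x 0≤δ ρ≤1 x∈Bρ = ⇒∈B B x (λ r r∈Γ → ℚP.≤-trans (∈B⇒ (_∣_ M B ρ) x x∈Bρ r r∈Γ) (begin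
    ρ * radius B    ≤⟨ *-monoʳ-≤ (radius B) 0≤δ ρ≤1 ⟩
    1ℚ * radius B   ≡⟨ ℚP.*-identityˡ (radius B) ⟩
    radius B        ∎))
    where open ℚP.≤-Reasoning

  ∈B-chain : ∀ {q} (Bs : Fin (suc q) → Bohr M) {ρ} → ρ ≤ 1ℚ → (∀ k → 0ℚ ≤ radius (Bs k)) →
    (∀ (i : Fin q) → _≤[_]_ M (Bs (suc i)) ρ (Bs (inject₁ i))) →
    ∀ k x → _∈B_ M x (Bs (suc k)) → _∈B_ M x (_∣_ M (Bs zero) ρ)
  ∈B-chain Bs ρ≤1 0≤δ nested zero    x x∈ = nested zero x x∈
  ∈B-chain Bs ρ≤1 0≤δ nested (suc k) x x∈ =
    ∈B-chain (Bs ∘ inject₁) ρ≤1 (0≤δ ∘ inject₁) (nested ∘ inject₁) k x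
      (∈B-dilate-≤1 (Bs (suc (inject₁ k))) x (0≤δ (suc (inject₁ k))) ρ≤1 (nested (suc k) x x∈))

ψ-rowSum : ∀ {q t} → LinMap q t → Fin t → ℚ
ψ-rowSum {q} φ i = Σℚ q (λ k → ℕ→ℚ ℤ.∣ ψ φ i k ∣)

module _ (m : ℕ) where

  private
    M : ℕ
    M = suc m

  -- ‖φᵢ(x)·r/M‖ ≤ ‖x₀·r/M‖ + Σₖ |ψᵢₖ| ‖xₖ·r/M‖ ≤ (1 - ρ')δ + (Σₖ |ψᵢₖ|) ρ δ ≤ δ.
  applyM-∈B : ∀ {q t} (φ : LinMap q t) → HasShape φ → (Bs : Fin (suc q) → Bohr M) → ∀ {ρ ρ'} →
    (∀ r → r ∈ freq (Bs zero) → ρ ≤ 1ℚ) → (∀ k → 0ℚ ≤ radius (Bs k)) →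
    (∀ (i : Fin q) → _≤[_]_ M (Bs (suc i)) ρ (Bs (inject₁ i))) →
    (∀ i → ψ-rowSum φ i * ρ ≤ ρ') →
    ∀ x → _∈B_ M (lookup x zero) (_∣_ M (Bs zero) (1ℚ - ρ')) → (∀ k → _∈B_ M (lookup x (suc k)) (Bs (suc k))) →
    ∀ i → _∈B_ M (applyM M φ x i) (Bs zero)
  applyM-∈B {q} φ shape Bs {ρ} {ρ'} ρ≤1 0≤δ nested rowρ≤ρ' x x₀∈ xₖ∈ i = ⇒∈B m (Bs zero) (applyM M φ x i) bound
    where
    δ = radius (Bs zero)
    ‖_·r‖ : Fin M → Fin M → ℚ
    ‖ y ·r‖ r = ‖_/M‖ M (mulM M y r)
    coefficient₀ : ∀ y → ℕ→ℚ ℤ.∣ φ i zero ∣ * y ≡ y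
    coefficient₀ y = trans (cong (λ c → ℕ→ℚ ℤ.∣ c ∣ * y) (shape i)) (ℚP.*-identityˡ y)
    bound : ∀ r → r ∈ freq (Bs zero) → ‖ applyM M φ x i ·r‖ r ≤ δ
    bound r r∈Γ = begin
      ‖ applyM M φ x i ·r‖ r
        ≤⟨ ‖applyM‖-≤ m φ x i r ⟩
      ℕ→ℚ ℤ.∣ φ i zero ∣ * ‖ lookup x zero ·r‖ r + Σℚ q (λ k → ℕ→ℚ ℤ.∣ ψ φ i k ∣ * ‖ lookup x (suc k) ·r‖ r)
        ≤⟨ ℚP.+-mono-≤ (ℚP.≤-reflexive (coefficient₀ (‖ lookup x zero ·r‖ r))) (Σℚ-mono-≤ q xₖ-bound) ⟩
      ‖ lookup x zero ·r‖ r + Σℚ q (λ k → ℕ→ℚ ℤ.∣ ψ φ i k ∣ * (ρ * δ))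
        ≤⟨ ℚP.+-mono-≤ (∈B⇒ m (_∣_ M (Bs zero) (1ℚ - ρ')) (lookup x zero) x₀∈ r r∈Γ)
                       (ℚP.≤-reflexive (Σℚ-*ʳ q (ρ * δ) (λ k → ℕ→ℚ ℤ.∣ ψ φ i k ∣))) ⟩
      (1ℚ - ρ') * δ + ψ-rowSum φ i * (ρ * δ)
        ≡⟨ cong (_+_ ((1ℚ - ρ') * δ)) (ℚP.*-assoc (ψ-rowSum φ i) ρ δ) ⟨
      (1ℚ - ρ') * δ + ψ-rowSum φ i * ρ * δ
        ≤⟨ ℚP.+-monoʳ-≤ ((1ℚ - ρ') * δ) (*-monoʳ-≤ δ (0≤δ zero) (rowρ≤ρ' i)) ⟩
      (1ℚ - ρ') * δ + ρ' * δ
        ≡⟨ recombine ρ' δ ⟩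
      δ ∎
      where
      open ℚP.≤-Reasoning
      recombine : ∀ ρ' δ → (1ℚ - ρ') * δ + ρ' * δ ≡ δ
      recombine = solve 2 (λ ρ' δ → (con 1ℚ :- ρ') :* δ :+ ρ' :* δ := δ) refl
      xₖ-bound : ∀ k → ℕ→ℚ ℤ.∣ ψ φ i k ∣ * ‖ lookup x (suc k) ·r‖ r ≤ ℕ→ℚ ℤ.∣ ψ φ i k ∣ * (ρ * δ)
      xₖ-bound k = *-monoˡ-≤ (ℕ→ℚ ℤ.∣ ψ φ i k ∣) (ℕ→ℚ-nonNeg ℤ.∣ ψ φ i k ∣)
        (∈B⇒ m (_∣_ M (Bs zero) ρ) (lookup x (suc k))
             (∈B-chain m Bs (ρ≤1 r r∈Γ) 0≤δ nested k (lookup x (suc k)) (xₖ∈ k)) r r∈Γ)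

Σℚ-indicator : ∀ n (p : Fin n → Bool) → Σℚ n (λ x → if p x then 1ℚ else 0ℚ) ≡ ℕ→ℚ (count n p)
Σℚ-indicator zero    p = refl
Σℚ-indicator (suc n) p = begin
  (if p zero then 1ℚ else 0ℚ) + Σℚ n (λ x → if p (suc x) then 1ℚ else 0ℚ)
    ≡⟨ cong₂ _+_ (indicator₀ (p zero)) (Σℚ-indicator n (p ∘ suc)) ⟩
  ℕ→ℚ (if p zero then 1 else 0) + ℕ→ℚ (count n (p ∘ suc))
    ≡⟨ ℕ→ℚ-+ (if p zero then 1 else 0) (count n (p ∘ suc)) ⟨
  ℕ→ℚ (count (suc n) p) ∎
  where
  open ≡-Reasoning
  indicator₀ : ∀ b → (if b then 1ℚ else 0ℚ) ≡ ℕ→ℚ (if b then 1 else 0)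
  indicator₀ true  = refl
  indicator₀ false = refl

∣∣≤count : ∀ n (A : Subset n) (p : Fin n → Bool) → (∀ x → x ∈ A → p x ≡ true) → ∣ A ∣ ℕ.≤ count n p
∣∣≤count zero    []            p A⊆p = z≤n
∣∣≤count (suc n) (outside ∷ A) p A⊆p = ℕP.≤-trans (∣∣≤count n A (p ∘ suc) (λ x x∈A → A⊆p (suc x) (there x∈A)))
                                                  (ℕP.m≤n+m (count n (p ∘ suc)) (if p zero then 1 else 0))
∣∣≤count (suc n) (inside ∷ A)  p A⊆p rewrite A⊆p zero here =
  s≤s (∣∣≤count n A (p ∘ suc) (λ x x∈A → A⊆p (suc x) (there x∈A)))

∈⇒1≤∣∣ : ∀ {n} {p : Subset n} {x} → x ∈ p → 1 ℕ.≤ ∣ p ∣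
∈⇒1≤∣∣ {p = inside ∷ p} here        = s≤s z≤n
∈⇒1≤∣∣ {p = b ∷ p}      (there x∈p) = ℕP.≤-trans (∈⇒1≤∣∣ x∈p) (SubsetP.∣p∣≤∣x∷p∣ b p)

count-pos : ∀ {n} (p : Fin n → Bool) i → p i ≡ true → 1 ℕ.≤ count n p
count-pos {suc n} p zero    pᵢ = subst (λ b → 1 ℕ.≤ (if b then 1 else 0) ℕ.+ count n (p ∘ suc)) (sym pᵢ) (s≤s z≤n)
count-pos {suc n} p (suc i) pᵢ = ℕP.≤-trans (count-pos (p ∘ suc) i pᵢ) (ℕP.m≤n+m (count n (p ∘ suc)) (if p zero then 1 else 0))

∈?-⊆ : ∀ {n} (A : Subset n) (p : Fin n → Bool) → (∀ x → x ∈ A → p x ≡ true) →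
  ∀ x → does (x ∈? A) ≡ true → p x ≡ true
∈?-⊆ A p A⊆p x with x ∈? A
... | yes x∈A = λ _ → A⊆p x x∈A
... | no  _   = λ ()

module _ (M : ℕ) .{{_ : NonZero M}} where

  𝟙B-∈ : ∀ B x → _∈B_ M x B → 𝟙B M B x ≡ 1ℚ
  𝟙B-∈ B x x∈B = cong (if_then 1ℚ else 0ℚ) x∈B

  𝟙B-∉ : ∀ B x → ¬ _∈B_ M x B → 𝟙B M B x ≡ 0ℚ
  𝟙B-∉ B x x∉B with inBohrᵇ M B x
  ... | true  = ⊥-elim (x∉B refl)
  ... | false = refl

  𝟙B-nonNeg : ∀ B x → 0ℚ ≤ 𝟙B M B x
  𝟙B-nonNeg B x with inBohrᵇ M B x
  ... | true  = ℚP.nonNegative⁻¹ 1ℚ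
  ... | false = ℚP.≤-refl

  Σ𝟙B≡size : ∀ B → Σℚ M (𝟙B M B) ≡ ℕ→ℚ (size M B)
  Σ𝟙B≡size B = Σℚ-indicator M (inBohrᵇ M B)

  density-≤1 : ∀ {B A α} → 0ℚ < ℕ→ℚ (size M B) → (∀ x → x ∈ A → _∈B_ M x B) →
    α * ℕ→ℚ (size M B) ≡ ℕ→ℚ ∣ A ∣ → α ≤ 1ℚ
  density-≤1 {B} {A} {α} 0<∣B∣ A⊆B α∣B∣≡∣A∣ = ℚP.*-cancelʳ-≤-pos (ℕ→ℚ (size M B)) {{ℚ.positive 0<∣B∣}} (begin
    α * ℕ→ℚ (size M B)    ≡⟨ α∣B∣≡∣A∣ ⟩
    ℕ→ℚ ∣ A ∣             ≤⟨ ℕ→ℚ-mono-≤ (∣∣≤count M A (inBohrᵇ M B) A⊆B) ⟩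
    ℕ→ℚ (size M B)        ≡⟨ ℚP.*-identityˡ (ℕ→ℚ (size M B)) ⟨
    1ℚ * ℕ→ℚ (size M B)   ∎)
    where open ℚP.≤-Reasoning

  density-nonNeg : ∀ {B} {A : Subset M} {α} → 0ℚ < ℕ→ℚ (size M B) → α * ℕ→ℚ (size M B) ≡ ℕ→ℚ ∣ A ∣ → 0ℚ ≤ α
  density-nonNeg {B} {A} {α} 0<∣B∣ α∣B∣≡∣A∣ = ℚP.*-cancelʳ-≤-pos (ℕ→ℚ (size M B)) {{ℚ.positive 0<∣B∣}} (begin
    0ℚ * ℕ→ℚ (size M B)   ≡⟨ ℚP.*-zeroˡ (ℕ→ℚ (size M B)) ⟩
    0ℚ                    ≤⟨ ℕ→ℚ-nonNeg ∣ A ∣ ⟩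
    ℕ→ℚ ∣ A ∣             ≡⟨ α∣B∣≡∣A∣ ⟨
    α * ℕ→ℚ (size M B)    ∎)
    where open ℚP.≤-Reasoning

size-pos : ∀ m B → 0ℚ ≤ radius B → 0ℚ < ℕ→ℚ (size (suc m) B)
size-pos m B 0≤δ = ℚP.<-≤-trans (ℚP.positive⁻¹ 1ℚ) (ℕ→ℚ-mono-≤ (count-pos (inBohrᵇ (suc m) B) zero (0∈B m B 0≤δ)))

withFirst : ∀ {M q} .{{_ : NonZero M}} → Bohr M → (Fin (suc q) → Bohr M) → Fin (suc q) → Bohr M
withFirst B₀' Bs zero    = B₀'
withFirst B₀' Bs (suc k) = Bs (suc k)

module _ (m : ℕ) where

  private
    M : ℕ
    M = suc m

  -- Off B₀' × B₁ × ⋯ × B_q the left side vanishes; on it, the inclusion hypothesis makes both sides α^t.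
  α𝟙B-summand-≥ : ∀ {q t} (φ : LinMap q t) (Bs : Fin (suc q) → Bohr M) (B₀' : Bohr M) {α} → 0ℚ ≤ α →
    (∀ y → _∈B_ M y B₀' → _∈B_ M y (Bs zero)) →
    (∀ x → _∈B_ M (lookup x zero) B₀' → (∀ k → _∈B_ M (lookup x (suc k)) (Bs (suc k))) →
       ∀ i → _∈B_ M (applyM M φ x i) (Bs zero)) →
    ∀ x → α ^ℚ t * Πℚ (suc q) (λ k → 𝟙B M (withFirst B₀' Bs k) (lookup x k))
        ≤ Πℚ (suc q) (λ k → 𝟙B M (Bs k) (lookup x k)) * Πℚ t (λ i → α * 𝟙B M (Bs zero) (applyM M φ x i))
  α𝟙B-summand-≥ {q} {t} φ Bs B₀' {α} 0≤α B₀'⊆B₀ inclusion x =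
    cases (inBohrᵇ M B₀' (lookup x zero) BoolP.≟ true) (FinP.all? (λ k → inBohrᵇ M (Bs (suc k)) (lookup x (suc k)) BoolP.≟ true))
    where
    weight′ weight image : ℚ
    weight′ = Πℚ (suc q) (λ k → 𝟙B M (withFirst B₀' Bs k) (lookup x k))
    weight  = Πℚ (suc q) (λ k → 𝟙B M (Bs k) (lookup x k))
    image   = Πℚ t (λ i → α * 𝟙B M (Bs zero) (applyM M φ x i))

    vanishing : ∀ k → 𝟙B M (withFirst B₀' Bs k) (lookup x k) ≡ 0ℚ → α ^ℚ t * weight′ ≤ weight * image
    vanishing k xₖ∉ = ℚP.≤-trans
      (ℚP.≤-reflexive (trans (cong (_*_ (α ^ℚ t)) (Πℚ-zero (suc q) (λ k → 𝟙B M (withFirst B₀' Bs k) (lookup x k)) k xₖ∉)) (ℚP.*-zeroʳ (α ^ℚ t))))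
      (*-nonNeg (Πℚ-nonNeg (suc q) (λ k → 𝟙B-nonNeg M (Bs k) (lookup x k)))
                (Πℚ-nonNeg t (λ i → *-nonNeg 0≤α (𝟙B-nonNeg M (Bs zero) (applyM M φ x i)))))

    all-inside : _∈B_ M (lookup x zero) B₀' → (∀ k → _∈B_ M (lookup x (suc k)) (Bs (suc k))) →
      α ^ℚ t * weight′ ≡ weight * image
    all-inside x₀∈ xₖ∈ = begin
      α ^ℚ t * weight′   ≡⟨ cong (_*_ (α ^ℚ t)) (Πℚ-one (suc q) (λ k → 𝟙B M (withFirst B₀' Bs k) (lookup x k)) weight′≡1) ⟩
      α ^ℚ t * 1ℚ        ≡⟨ ℚP.*-comm (α ^ℚ t) 1ℚ ⟩
      1ℚ * α ^ℚ t        ≡⟨ cong₂ _*_ (Πℚ-one (suc q) (λ k → 𝟙B M (Bs k) (lookup x k)) weight≡1)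
                                      (Πℚ-const t (λ i → α * 𝟙B M (Bs zero) (applyM M φ x i)) α onto) ⟨
      weight * image     ∎
      where
      open ≡-Reasoning
      weight′≡1 : ∀ k → 𝟙B M (withFirst B₀' Bs k) (lookup x k) ≡ 1ℚ
      weight′≡1 zero    = 𝟙B-∈ M B₀' (lookup x zero) x₀∈
      weight′≡1 (suc k) = 𝟙B-∈ M (Bs (suc k)) (lookup x (suc k)) (xₖ∈ k)
      weight≡1 : ∀ k → 𝟙B M (Bs k) (lookup x k) ≡ 1ℚ
      weight≡1 zero    = 𝟙B-∈ M (Bs zero) (lookup x zero) (B₀'⊆B₀ (lookup x zero) x₀∈)
      weight≡1 (suc k) = 𝟙B-∈ M (Bs (suc k)) (lookup x (suc k)) (xₖ∈ k)
      onto : ∀ i → α * 𝟙B M (Bs zero) (applyM M φ x i) ≡ α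
      onto i = trans (cong (_*_ α) (𝟙B-∈ M (Bs zero) (applyM M φ x i) (inclusion x x₀∈ xₖ∈ i))) (ℚP.*-identityʳ α)

    cases : Dec (_∈B_ M (lookup x zero) B₀') → Dec (∀ k → _∈B_ M (lookup x (suc k)) (Bs (suc k))) →
      α ^ℚ t * weight′ ≤ weight * image
    cases (no x₀∉)  _          = vanishing zero (𝟙B-∉ M B₀' (lookup x zero) x₀∉)
    cases (yes x₀∈) (yes xₖ∈)  = ℚP.≤-reflexive (all-inside x₀∈ xₖ∈)
    cases (yes x₀∈) (no ¬xₖ∈) =
      let k , xₖ∉ = FinP.¬∀⟶∃¬ q _ (λ k → inBohrᵇ M (Bs (suc k)) (lookup x (suc k)) BoolP.≟ true) ¬xₖ∈
      in vanishing (suc k) (𝟙B-∉ M (Bs (suc k)) (lookup x (suc k)) xₖ∉)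

  T-α𝟙B-≥ : ∀ {q t} (φ : LinMap q t) (Bs : Fin (suc q) → Bohr M) (B₀' : Bohr M) {α h} → 0ℚ ≤ α → 0ℚ ≤ h →
    (∀ k → 0ℚ ≤ radius (Bs k)) →
    (∀ y → _∈B_ M y B₀' → _∈B_ M y (Bs zero)) →
    (∀ x → _∈B_ M (lookup x zero) B₀' → (∀ k → _∈B_ M (lookup x (suc k)) (Bs (suc k))) →
       ∀ i → _∈B_ M (applyM M φ x i) (Bs zero)) →
    h * ℕ→ℚ (size M (Bs zero)) ≤ ℕ→ℚ (size M B₀') →
    α ^ℚ t * h ≤ T M φ Bs (λ _ y → α * 𝟙B M (Bs zero) y)
  T-α𝟙B-≥ {q} {t} φ Bs B₀' {α} {h} 0≤α 0≤h 0≤δ B₀'⊆B₀ inclusion h∣B₀∣≤∣B₀'∣ = begin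
    α ^ℚ t * h                                      ≡⟨ cancel (α ^ℚ t) h D (inv D) (*-inv 0<D) ⟨
    α ^ℚ t * (h * (∣B₀∣ * ∣Bₖ∣)) * inv D             ≤⟨ *-monoʳ-≤ (inv D) (ℚP.<⇒≤ (inv-pos 0<D))
                                                         (*-monoˡ-≤ (α ^ℚ t) (^ℚ-nonNeg t 0≤α) h∣B∣≤∣B′∣) ⟩
    α ^ℚ t * (∣B₀'∣ * ∣Bₖ∣) * inv D                   ≡⟨ cong (λ v → α ^ℚ t * v * inv D) count′ ⟨
    α ^ℚ t * ΣVec M (suc q) weight′ * inv D          ≤⟨ *-monoʳ-≤ (inv D) (ℚP.<⇒≤ (inv-pos 0<D)) pointwise ⟩
    T M φ Bs (λ _ y → α * 𝟙B M (Bs zero) y)          ∎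
    where
    open ℚP.≤-Reasoning
    ∣B₀∣ = ℕ→ℚ (size M (Bs zero))
    ∣B₀'∣ = ℕ→ℚ (size M B₀')
    ∣Bₖ∣ = Πℚ q (λ k → ℕ→ℚ (size M (Bs (suc k))))
    D = Πℚ (suc q) (λ k → ℕ→ℚ (size M (Bs k)))
    0<D : 0ℚ < D
    0<D = Πℚ-pos (suc q) (λ k → size-pos m (Bs k) (0≤δ k))
    weight′ : Vec (Fin M) (suc q) → ℚ
    weight′ x = Πℚ (suc q) (λ k → 𝟙B M (withFirst B₀' Bs k) (lookup x k))
    count′ : ΣVec M (suc q) weight′ ≡ ∣B₀'∣ * ∣Bₖ∣
    count′ = trans (ΣVec-Πℚ M (suc q) (λ k → 𝟙B M (withFirst B₀' Bs k)))
                   (Πℚ-cong (suc q) (λ k → Σ𝟙B≡size M (withFirst B₀' Bs k)))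
    h∣B∣≤∣B′∣ : h * D ≤ ∣B₀'∣ * ∣Bₖ∣
    h∣B∣≤∣B′∣ = ℚP.≤-trans (ℚP.≤-reflexive (sym (ℚP.*-assoc h ∣B₀∣ ∣Bₖ∣)))
                           (*-monoʳ-≤ ∣Bₖ∣ (Πℚ-nonNeg q (λ k → ℕ→ℚ-nonNeg (size M (Bs (suc k))))) h∣B₀∣≤∣B₀'∣)
    T-numerator : ℚ
    T-numerator = ΣVec M (suc q) (λ x → Πℚ (suc q) (λ k → 𝟙B M (Bs k) (lookup x k)) * Πℚ t (λ i → α * 𝟙B M (Bs zero) (applyM M φ x i)))
    pointwise : α ^ℚ t * ΣVec M (suc q) weight′ ≤ T-numerator
    pointwise = ℚP.≤-trans (ℚP.≤-reflexive (sym (ΣVec-*ˡ M (suc q) (α ^ℚ t) weight′)))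
                           (ΣVec-mono-≤ M (suc q) (α𝟙B-summand-≥ φ Bs B₀' 0≤α B₀'⊆B₀ inclusion))
    cancel : ∀ a h D W → D * W ≡ 1ℚ → a * (h * D) * W ≡ a * h
    cancel a h D W DW≡1 = trans (reassociate a h D W) (trans (cong (_*_ (a * h)) DW≡1) (ℚP.*-identityʳ (a * h)))
      where
      reassociate : ∀ a h D W → a * (h * D) * W ≡ a * h * (D * W)
      reassociate = solve 4 (λ a h D W → a :* (h :* D) :* W := a :* h :* (D :* W)) refl

-- hybrid G H i = (H₀, …, H_{i-1}, Gᵢ - Hᵢ, G_{i+1}, …, G_{n-1})
hybrid : ∀ {n} {X : Set} → (Fin n → X → ℚ) → (Fin n → X → ℚ) → Fin n → Fin n → X → ℚ
hybrid G H zero    zero    y = G zero y - H zero y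
hybrid G H zero    (suc j) y = G (suc j) y
hybrid G H (suc i) zero    y = H zero y
hybrid G H (suc i) (suc j) y = hybrid (G ∘ suc) (H ∘ suc) i j y

hybrid-diagonal : ∀ {n} {X : Set} (G H : Fin n → X → ℚ) i y → hybrid G H i i y ≡ G i y - H i y
hybrid-diagonal G H zero    y = refl
hybrid-diagonal G H (suc i) y = hybrid-diagonal (G ∘ suc) (H ∘ suc) i y

hybrid-preserves : ∀ {n} {X : Set} (P : ℚ → Set) (G H : Fin n → X → ℚ) →
  (∀ j y → P (G j y)) → (∀ j y → P (H j y)) → (∀ j y → P (G j y - H j y)) → ∀ i j y → P (hybrid G H i j y)
hybrid-preserves P G H PG PH PG-H zero    zero    y = PG-H zero y
hybrid-preserves P G H PG PH PG-H zero    (suc j) y = PG (suc j) y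
hybrid-preserves P G H PG PH PG-H (suc i) zero    y = PH zero y
hybrid-preserves P G H PG PH PG-H (suc i) (suc j) y =
  hybrid-preserves P (G ∘ suc) (H ∘ suc) (PG ∘ suc) (PH ∘ suc) (PG-H ∘ suc) i j y

Πℚ-telescope : ∀ n {X : Set} (G H : Fin n → X → ℚ) (p : Fin n → X) →
  Πℚ n (λ j → G j (p j)) ≡ Πℚ n (λ j → H j (p j)) + Σℚ n (λ i → Πℚ n (λ j → hybrid G H i j (p j)))
Πℚ-telescope zero    G H p = sym (ℚP.+-identityʳ 1ℚ)
Πℚ-telescope (suc n) G H p = begin
  g * a                                  ≡⟨ step g h a b s (Πℚ-telescope n (G ∘ suc) (H ∘ suc) (p ∘ suc)) ⟩
  h * b + ((g - h) * a + h * s)          ≡⟨ cong (λ v → h * b + ((g - h) * a + v)) (Σℚ-*ˡ n h (λ i → Πℚ n (λ j → hybrid (G ∘ suc) (H ∘ suc) i j (p (suc j))))) ⟨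
  h * b + ((g - h) * a + Σℚ n (λ i → h * Πℚ n (λ j → hybrid (G ∘ suc) (H ∘ suc) i j (p (suc j)))))  ∎
  where
  open ≡-Reasoning
  g = G zero (p zero)
  h = H zero (p zero)
  a = Πℚ n (λ j → G (suc j) (p (suc j)))
  b = Πℚ n (λ j → H (suc j) (p (suc j)))
  s = Σℚ n (λ i → Πℚ n (λ j → hybrid (G ∘ suc) (H ∘ suc) i j (p (suc j))))
  step : ∀ g h a b s → a ≡ b + s → g * a ≡ h * b + ((g - h) * a + h * s)
  step g h a b s refl = expand g h b s
    where
    expand : ∀ g h b s → g * (b + s) ≡ h * b + ((g - h) * (b + s) + h * s)
    expand = solve 4 (λ g h b s → g :* (b :+ s) := h :* b :+ ((g :- h) :* (b :+ s) :+ h :* s)) refl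

T-telescope : ∀ {q t} (M : ℕ) .{{_ : NonZero M}} (φ : LinMap q t) (Bs : Fin (suc q) → Bohr M) (G H : Fin t → Fin M → ℚ) →
  T M φ Bs G ≡ T M φ Bs H + Σℚ t (λ i → T M φ Bs (hybrid G H i))
T-telescope {q} {t} M φ Bs G H = begin
  S G * W                                              ≡⟨ cong (_* W) sum-telescope ⟩
  (S H + Σℚ t (λ i → S (hybrid G H i))) * W            ≡⟨ ℚP.*-distribʳ-+ W (S H) (Σℚ t (λ i → S (hybrid G H i))) ⟩
  S H * W + Σℚ t (λ i → S (hybrid G H i)) * W          ≡⟨ cong (_+_ (S H * W)) (Σℚ-*ʳ t W (λ i → S (hybrid G H i))) ⟨
  S H * W + Σℚ t (λ i → S (hybrid G H i) * W)          ∎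
  where
  open ≡-Reasoning
  weight : Vec (Fin M) (suc q) → ℚ
  weight x = Πℚ (suc q) (λ k → 𝟙B M (Bs k) (lookup x k))
  W = inv (Πℚ (suc q) (λ k → ℕ→ℚ (size M (Bs k))))
  Π : (Fin t → Fin M → ℚ) → Vec (Fin M) (suc q) → ℚ
  Π f x = Πℚ t (λ i → f i (applyM M φ x i))
  S : (Fin t → Fin M → ℚ) → ℚ
  S f = ΣVec M (suc q) (λ x → weight x * Π f x)
  pointwise : ∀ x → weight x * Π G x ≡ weight x * Π H x + Σℚ t (λ i → weight x * Π (hybrid G H i) x)
  pointwise x = begin
    weight x * Π G x                                                  ≡⟨ cong (_*_ (weight x)) (Πℚ-telescope t G H (applyM M φ x)) ⟩
    weight x * (Π H x + Σℚ t (λ i → Π (hybrid G H i) x))              ≡⟨ ℚP.*-distribˡ-+ (weight x) (Π H x) (Σℚ t (λ i → Π (hybrid G H i) x)) ⟩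
    weight x * Π H x + weight x * Σℚ t (λ i → Π (hybrid G H i) x)     ≡⟨ cong (_+_ (weight x * Π H x)) (Σℚ-*ˡ t (weight x) (λ i → Π (hybrid G H i) x)) ⟨
    weight x * Π H x + Σℚ t (λ i → weight x * Π (hybrid G H i) x)     ∎
  sum-telescope : S G ≡ S H + Σℚ t (λ i → S (hybrid G H i))
  sum-telescope = begin
    S G                                                                  ≡⟨ ΣVec-cong M (suc q) pointwise ⟩
    ΣVec M (suc q) (λ x → weight x * Π H x + Σℚ t (λ i → weight x * Π (hybrid G H i) x))
                                                                         ≡⟨ ΣVec-distrib-+ M (suc q) (λ x → weight x * Π H x) (λ x → Σℚ t (λ i → weight x * Π (hybrid G H i) x)) ⟩
    S H + ΣVec M (suc q) (λ x → Σℚ t (λ i → weight x * Π (hybrid G H i) x))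
                                                                         ≡⟨ cong (_+_ (S H)) (ΣVec-Σℚ M (suc q) t (λ i x → weight x * Π (hybrid G H i) x)) ⟩
    S H + Σℚ t (λ i → S (hybrid G H i))                                  ∎

InUnitInterval : ℚ → Set
InUnitInterval v = - 1ℚ ≤ v × v ≤ 1ℚ

module _ {α : ℚ} (0≤α : 0ℚ ≤ α) (α≤1 : α ≤ 1ℚ) where

  private
    -1≤0 : - 1ℚ ≤ 0ℚ
    -1≤0 = ℚP.nonPositive⁻¹ (- 1ℚ)

    0≤1 : 0ℚ ≤ 1ℚ
    0≤1 = ℚP.nonNegative⁻¹ 1ℚ

    -1≤-α : - 1ℚ ≤ - α
    -1≤-α = ℚP.neg-antimono-≤ α≤1

    -α≤0 : - α ≤ 0ℚ
    -α≤0 = ℚP.neg-antimono-≤ 0≤α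

  indicator-∈[-1,1] : ∀ b → InUnitInterval (if b then 1ℚ else 0ℚ)
  indicator-∈[-1,1] true  = ℚP.≤-trans -1≤0 0≤1 , ℚP.≤-refl
  indicator-∈[-1,1] false = -1≤0 , 0≤1

  scaled-indicator-∈[-1,1] : ∀ b → InUnitInterval (α * (if b then 1ℚ else 0ℚ))
  scaled-indicator-∈[-1,1] true  rewrite ℚP.*-identityʳ α = ℚP.≤-trans -1≤0 0≤α , α≤1
  scaled-indicator-∈[-1,1] false rewrite ℚP.*-zeroʳ α = -1≤0 , 0≤1

  indicator-difference-∈[-1,1] : ∀ u v → (u ≡ true → v ≡ true) →
    InUnitInterval ((if u then 1ℚ else 0ℚ) - α * (if v then 1ℚ else 0ℚ))
  indicator-difference-∈[-1,1] true  true  _ rewrite ℚP.*-identityʳ α =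
    ℚP.≤-trans -1≤0 (ℚP.+-monoʳ-≤ 1ℚ -1≤-α) , ℚP.+-monoʳ-≤ 1ℚ -α≤0
  indicator-difference-∈[-1,1] true  false u⇒v with () ← u⇒v refl
  indicator-difference-∈[-1,1] false true  _ rewrite ℚP.*-identityʳ α | ℚP.+-identityˡ (- α) = -1≤-α , ℚP.≤-trans -α≤0 0≤1
  indicator-difference-∈[-1,1] false false _ rewrite ℚP.*-zeroʳ α = -1≤0 , 0≤1

-p≤∣p∣ : ∀ p → - p ≤ ℚ.∣ p ∣
-p≤∣p∣ p with ℚP.∣p∣≡p∨∣p∣≡-p p
... | inj₁ ∣p∣≡p = ℚP.≤-trans (ℚP.neg-antimono-≤ 0≤p) (ℚP.≤-trans 0≤p (ℚP.≤-reflexive (sym ∣p∣≡p)))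
  where 0≤p = ℚP.∣p∣≡p⇒0≤p ∣p∣≡p
... | inj₂ ∣p∣≡-p = ℚP.≤-reflexive (sym ∣p∣≡-p)

<-neg⇒≤∣∣ : ∀ {g y} → g < - y → y ≤ ℚ.∣ g ∣
<-neg⇒≤∣∣ {g} {y} g<-y = ℚP.≤-trans (ℚP.<⇒≤ y<-g) (-p≤∣p∣ g)
  where
  neg-involutive : ∀ y → - (- y) ≡ y
  neg-involutive = solve 1 (λ y → :- (:- y) := y) refl
  y<-g : y < - g
  y<-g = subst (_< - g) (neg-involutive y) (ℚP.neg-antimono-< g<-y)

¼ ½ : ℚ
¼ = 1ℚ ÷ ℕ→ℚ 4
½ = 1ℚ ÷ ℕ→ℚ 2

ψ-size : ∀ {q t} → LinMap q t → ℚ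
ψ-size {t = t} φ = Σℚ t (ψ-rowSum φ)

ψ-rowSum-nonNeg : ∀ {q t} (φ : LinMap q t) i → 0ℚ ≤ ψ-rowSum φ i
ψ-rowSum-nonNeg {q} φ i = Σℚ-nonNeg q (λ k → ℕ→ℚ-nonNeg ℤ.∣ ψ φ i k ∣)

ψ-size-nonNeg : ∀ {q t} (φ : LinMap q t) → 0ℚ ≤ ψ-size φ
ψ-size-nonNeg {t = t} φ = Σℚ-nonNeg t (ψ-rowSum-nonNeg φ)

256*-nonNeg : ∀ {X} → 0ℚ ≤ X → 0ℚ ≤ ℕ→ℚ 256 * X
256*-nonNeg = *-nonNeg (ℕ→ℚ-nonNeg 256)

c[_] : ∀ {q t} → LinMap q t → ℚ
c[ φ ] = inv (1ℚ + ℕ→ℚ 256 * ψ-size φ)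

c[φ]-pos : ∀ {q t} (φ : LinMap q t) → 0ℚ < c[ φ ]
c[φ]-pos φ = inv-pos (1+-pos (256*-nonNeg (ψ-size-nonNeg φ)))

⊔0-*-≤-c[φ] : ∀ {q t} (φ : LinMap q t) d {ρ} → ρ * ℕ→ℚ d ≤ c[ φ ] → (ρ ⊔ 0ℚ) * ℕ→ℚ d ≤ c[ φ ]
⊔0-*-≤-c[φ] φ d {ρ} ρd≤c = begin
  (ρ ⊔ 0ℚ) * ℕ→ℚ d          ≡⟨ ℚP.*-distribʳ-⊔-nonNeg (ℕ→ℚ d) {{ℚ.nonNegative (ℕ→ℚ-nonNeg d)}} ρ 0ℚ ⟩
  ρ * ℕ→ℚ d ⊔ 0ℚ * ℕ→ℚ d    ≤⟨ ℚP.⊔-lub ρd≤c 0d≤c ⟩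
  c[ φ ]                    ∎
  where
  open ℚP.≤-Reasoning
  0d≤c : 0ℚ * ℕ→ℚ d ≤ c[ φ ]
  0d≤c = ℚP.≤-trans (ℚP.≤-reflexive (ℚP.*-zeroˡ (ℕ→ℚ d))) (ℚP.<⇒≤ (c[φ]-pos φ))

-- 64 (ρ⁺ R + e) d = ¼ · 256 R (ρ⁺ d) + ¼ · 256 d e, and each product is at most 1.
dilation-margin : ∀ {R d ρ⁺ e} → 0ℚ ≤ R → 0ℚ ≤ d → 0ℚ ≤ ρ⁺ → 0ℚ ≤ e →
  ρ⁺ * d ≤ inv (1ℚ + ℕ→ℚ 256 * R) → e ≤ inv (1ℚ + ℕ→ℚ 256 * d) →
  ℕ→ℚ 64 * (ρ⁺ * R + e) * d ≤ ½
dilation-margin {R} {d} {ρ⁺} {e} 0≤R 0≤d 0≤ρ⁺ 0≤e ρ⁺d≤ e≤ = begin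
  ℕ→ℚ 64 * (ρ⁺ * R + e) * d                              ≡⟨ split ρ⁺ R e d ⟩
  ¼ * (ℕ→ℚ 256 * R * (ρ⁺ * d)) + ¼ * (ℕ→ℚ 256 * d * e)   ≤⟨ ℚP.+-mono-≤ (quarter (*-≤-inv-1+ (256*-nonNeg 0≤R) (*-nonNeg 0≤ρ⁺ 0≤d) ρ⁺d≤))
                                                                         (quarter (*-≤-inv-1+ (256*-nonNeg 0≤d) 0≤e e≤)) ⟩
  ¼ * 1ℚ + ¼ * 1ℚ                                        ≡⟨⟩
  ½                                                      ∎
  where
  open ℚP.≤-Reasoning
  split : ∀ ρ⁺ R e d → ℕ→ℚ 64 * (ρ⁺ * R + e) * d ≡ ¼ * (ℕ→ℚ 256 * R * (ρ⁺ * d)) + ¼ * (ℕ→ℚ 256 * d * e)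
  split = solve 4 (λ ρ⁺ R e d → con (ℕ→ℚ 64) :* (ρ⁺ :* R :+ e) :* d
                             := con ¼ :* (con (ℕ→ℚ 256) :* R :* (ρ⁺ :* d)) :+ con ¼ :* (con (ℕ→ℚ 256) :* d :* e)) refl
  quarter : ∀ {X} → X ≤ 1ℚ → ¼ * X ≤ ¼ * 1ℚ
  quarter = *-monoˡ-≤ ¼ (ℚP.nonNegative⁻¹ ¼)

-- ρ' = (ρ ⊔ 0) Σ|ψ| + 1/(1 + 256 d): positive as regularity requires, and small when ρd ≤ c[φ].
admissible-dilation : ∀ {q t} (φ : LinMap q t) d {ρ} → ρ * ℕ→ℚ d ≤ c[ φ ] →
  Σ ℚ λ ρ' → 0ℚ < ρ' × ℕ→ℚ 64 * ρ' * ℕ→ℚ d ≤ ½ × (∀ i → ψ-rowSum φ i * ρ ≤ ρ')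
admissible-dilation {t = t} φ d {ρ} ρd≤c = ρ⁺ * R + e , 0<ρ' , margin , row≤
  where
  R = ψ-size φ
  ρ⁺ = ρ ⊔ 0ℚ
  e = inv (1ℚ + ℕ→ℚ 256 * ℕ→ℚ d)
  0≤ρ⁺ : 0ℚ ≤ ρ⁺
  0≤ρ⁺ = ℚP.p≤q⊔p ρ 0ℚ
  0<e : 0ℚ < e
  0<e = inv-pos (1+-pos (256*-nonNeg (ℕ→ℚ-nonNeg d)))
  0<ρ' : 0ℚ < ρ⁺ * R + e
  0<ρ' = ℚP.+-mono-≤-< (*-nonNeg 0≤ρ⁺ (ψ-size-nonNeg φ)) 0<e
  margin : ℕ→ℚ 64 * (ρ⁺ * R + e) * ℕ→ℚ d ≤ ½
  margin = dilation-margin (ψ-size-nonNeg φ) (ℕ→ℚ-nonNeg d) 0≤ρ⁺ (ℚP.<⇒≤ 0<e) (⊔0-*-≤-c[φ] φ d {ρ} ρd≤c) ℚP.≤-refl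
  row≤ : ∀ i → ψ-rowSum φ i * ρ ≤ ρ⁺ * R + e
  row≤ i = begin
    ψ-rowSum φ i * ρ     ≤⟨ *-monoˡ-≤ (ψ-rowSum φ i) (ψ-rowSum-nonNeg φ i) (ℚP.p≤p⊔q ρ 0ℚ) ⟩
    ψ-rowSum φ i * ρ⁺    ≤⟨ *-monoʳ-≤ ρ⁺ 0≤ρ⁺ (term≤Σℚ t (ψ-rowSum-nonNeg φ) i) ⟩
    R * ρ⁺               ≡⟨ ℚP.*-comm R ρ⁺ ⟩
    ρ⁺ * R               ≡⟨ ℚP.+-identityʳ (ρ⁺ * R) ⟨
    ρ⁺ * R + 0ℚ          ≤⟨ ℚP.+-monoʳ-≤ (ρ⁺ * R) (ℚP.<⇒≤ 0<e) ⟩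
    ρ⁺ * R + e           ∎
    where open ℚP.≤-Reasoning

scale-≤1 : ∀ {q t} (φ : LinMap q t) {d ρ} → 1 ℕ.≤ d → ρ * ℕ→ℚ d ≤ c[ φ ] → ρ ≤ 1ℚ
scale-≤1 φ {d} {ρ} 1≤d ρd≤c = begin
  ρ                   ≤⟨ ℚP.p≤p⊔q ρ 0ℚ ⟩
  ρ ⊔ 0ℚ              ≡⟨ ℚP.*-identityʳ (ρ ⊔ 0ℚ) ⟨
  (ρ ⊔ 0ℚ) * 1ℚ       ≤⟨ *-monoˡ-≤ (ρ ⊔ 0ℚ) (ℚP.p≤q⊔p ρ 0ℚ) (ℕ→ℚ-mono-≤ 1≤d) ⟩
  (ρ ⊔ 0ℚ) * ℕ→ℚ d    ≤⟨ ⊔0-*-≤-c[φ] φ d {ρ} ρd≤c ⟩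
  c[ φ ]              ≤⟨ inv-1+-≤1 (256*-nonNeg (ψ-size-nonNeg φ)) ⟩
  1ℚ                  ∎
  where open ℚP.≤-Reasoning

LargeHybrid : ∀ {q t} (M : ℕ) .{{_ : NonZero M}} → LinMap q t → (Fin (suc q) → Bohr M) → Subset M → ℚ → ℚ → Set
LargeHybrid {t = t} M φ Bs A α c′ = Σ (Fin t → Fin M → ℚ) λ f → (∀ i → Bounded M (f i)) ×
  Σ (Fin t) λ i → (∀ x → f i x ≡ 𝟙 M A x - α * 𝟙B M (Bs zero) x) × c′ * α ^ℚ t ≤ ℚ.∣ T M φ Bs f ∣

module _ (m : ℕ) where

  private
    M : ℕ
    M = suc m

  T-α𝟙B-≥-half : ∀ {q t} (φ : LinMap q t) → HasShape φ → (Bs : Fin (suc q) → Bohr M) →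
    (∀ k → 0ℚ < radius (Bs k)) → (∀ k → Regular M (Bs k)) →
    ∀ {ρ} → ρ * ℕ→ℚ (dim M (Bs zero)) ≤ c[ φ ] →
    (∀ (i : Fin q) → _≤[_]_ M (Bs (suc i)) ρ (Bs (inject₁ i))) →
    ∀ {α} → 0ℚ ≤ α → α ^ℚ t * ½ ≤ T M φ Bs (λ _ y → α * 𝟙B M (Bs zero) y)
  T-α𝟙B-≥-half φ shape Bs 0<δ regular {ρ} ρd≤c nested 0≤α =
    T-α𝟙B-≥ m φ Bs B₀' 0≤α (ℚP.nonNegative⁻¹ ½) 0≤δ B₀'⊆B₀ inclusion half-inside
    where
    dilation = admissible-dilation φ (dim M (Bs zero)) {ρ} ρd≤c
    ρ' = proj₁ dilation
    0<ρ' : 0ℚ < ρ'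
    0<ρ' = proj₁ (proj₂ dilation)
    margin : ℕ→ℚ 64 * ρ' * ℕ→ℚ (dim M (Bs zero)) ≤ ½
    margin = proj₁ (proj₂ (proj₂ dilation))
    B₀' = _∣_ M (Bs zero) (1ℚ - ρ')
    0≤δ : ∀ k → 0ℚ ≤ radius (Bs k)
    0≤δ k = ℚP.<⇒≤ (0<δ k)
    1-ρ'≤1 : 1ℚ - ρ' ≤ 1ℚ
    1-ρ'≤1 = ℚP.≤-trans (ℚP.+-monoʳ-≤ 1ℚ (ℚP.neg-antimono-≤ (ℚP.<⇒≤ 0<ρ'))) (ℚP.≤-reflexive (ℚP.+-identityʳ 1ℚ))
    B₀'⊆B₀ : ∀ y → _∈B_ M y B₀' → _∈B_ M y (Bs zero)
    B₀'⊆B₀ y = ∈B-dilate-≤1 m (Bs zero) y (0≤δ zero) 1-ρ'≤1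
    inclusion : ∀ x → _∈B_ M (lookup x zero) B₀' → (∀ k → _∈B_ M (lookup x (suc k)) (Bs (suc k))) →
      ∀ i → _∈B_ M (applyM M φ x i) (Bs zero)
    inclusion = applyM-∈B m φ shape Bs {ρ} {ρ'} (λ r r∈Γ → scale-≤1 φ {dim M (Bs zero)} {ρ} (∈⇒1≤∣∣ r∈Γ) ρd≤c) 0≤δ nested
                          (proj₂ (proj₂ (proj₂ dilation)))
    ½≤1-64ρ'd : ½ ≤ 1ℚ - ℕ→ℚ 64 * ρ' * ℕ→ℚ (dim M (Bs zero))
    ½≤1-64ρ'd = ℚP.+-monoʳ-≤ 1ℚ (ℚP.neg-antimono-≤ margin)
    half-inside : ½ * ℕ→ℚ (size M (Bs zero)) ≤ ℕ→ℚ (size M B₀')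
    half-inside = ℚP.≤-trans (*-monoʳ-≤ (ℕ→ℚ (size M (Bs zero))) (ℕ→ℚ-nonNeg (size M (Bs zero))) ½≤1-64ρ'd)
      (proj₁ (proj₂ (regular zero ρ' 0<ρ' (ℚP.≤-trans margin ½≤1))))
      where
      ½≤1 : ½ ≤ 1ℚ
      ½≤1 = ℚP.≤ᵇ⇒≤ _

  counting-dichotomy : ∀ {q t} (φ : LinMap q (suc t)) → HasShape φ → (Bs : Fin (suc q) → Bohr M) →
    (∀ k → 0ℚ < radius (Bs k)) → (∀ k → Regular M (Bs k)) →
    ∀ ρ → ρ * ℕ→ℚ (dim M (Bs zero)) ≤ c[ φ ] →
    (∀ (i : Fin q) → _≤[_]_ M (Bs (suc i)) ρ (Bs (inject₁ i))) →
    ∀ A → (∀ x → x ∈ A → _∈B_ M x (Bs zero)) →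
    ∀ α → α * ℕ→ℚ (size M (Bs zero)) ≡ ℕ→ℚ ∣ A ∣ →
    α ^ℚ suc t * ¼ ≤ T M φ Bs (λ _ → 𝟙 M A) ⊎ LargeHybrid M φ Bs A α (¼ * inv (ℕ→ℚ (suc t)))
  counting-dichotomy {q} {t} φ shape Bs 0<δ regular ρ ρd≤c nested A A⊆B₀ α density =
    decide (α ^ℚ suc t * ¼ ℚP.≤? T M φ Bs G)
    where
    G H : Fin (suc t) → Fin M → ℚ
    G _ = 𝟙 M A
    H _ y = α * 𝟙B M (Bs zero) y
    a = α ^ℚ suc t
    b = - (¼ * inv (ℕ→ℚ (suc t)) * a)
    g : Fin (suc t) → ℚ
    g i = T M φ Bs (hybrid G H i)
    0<∣B₀∣ = size-pos m (Bs zero) (ℚP.<⇒≤ (0<δ zero))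
    0≤α = density-nonNeg M {Bs zero} {A} {α} 0<∣B₀∣ density
    α≤1 = density-≤1 M {Bs zero} {A} {α} 0<∣B₀∣ A⊆B₀ density

    bounded : ∀ i j → Bounded M (hybrid G H i j)
    bounded i j y = hybrid-preserves InUnitInterval G H
      (λ _ y → indicator-∈[-1,1] 0≤α α≤1 (does (y ∈? A)))
      (λ _ y → scaled-indicator-∈[-1,1] 0≤α α≤1 (inBohrᵇ M (Bs zero) y))
      (λ _ y → indicator-difference-∈[-1,1] 0≤α α≤1 (does (y ∈? A)) (inBohrᵇ M (Bs zero) y)
                 (∈?-⊆ A (inBohrᵇ M (Bs zero)) A⊆B₀ y))
      i j y

    hybrids-small : T M φ Bs G < a * ¼ → Σℚ (suc t) g < Σℚ (suc t) (λ _ → b)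
    hybrids-small X<a¼ = begin-strict
      Σℚ (suc t) g                      ≡⟨ difference (T-telescope M φ Bs G H) ⟩
      T M φ Bs G - T M φ Bs H           <⟨ ℚP.+-mono-<-≤ X<a¼ (ℚP.neg-antimono-≤ (T-α𝟙B-≥-half φ shape Bs 0<δ regular {ρ} ρd≤c nested {α} 0≤α)) ⟩
      a * ¼ - a * ½                     ≡⟨ quarter a ⟩
      - (¼ * a) * 1ℚ                    ≡⟨ cong (_*_ (- (¼ * a))) (*-inv (ℕ→ℚ-pos t)) ⟨
      - (¼ * a) * (ℕ→ℚ (suc t) * inv (ℕ→ℚ (suc t)))  ≡⟨ reassociate a (ℕ→ℚ (suc t)) (inv (ℕ→ℚ (suc t))) ⟩
      ℕ→ℚ (suc t) * b                   ≡⟨ Σℚ-const (suc t) b ⟨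
      Σℚ (suc t) (λ _ → b)              ∎
      where
      open ℚP.≤-Reasoning
      difference : ∀ {X Y S} → X ≡ Y + S → S ≡ X - Y
      difference {Y = Y} {S} refl = cancel Y S
        where
        cancel : ∀ Y S → S ≡ Y + S - Y
        cancel = solve 2 (λ Y S → S := Y :+ S :- Y) refl
      quarter : ∀ a → a * ¼ - a * ½ ≡ - (¼ * a) * 1ℚ
      quarter = solve 1 (λ a → a :* con ¼ :- a :* con ½ := :- (con ¼ :* a) :* con 1ℚ) refl
      reassociate : ∀ a n w → - (¼ * a) * (n * w) ≡ n * - (¼ * w * a)
      reassociate = solve 3 (λ a n w → :- (con ¼ :* a) :* (n :* w) := n :* :- (con ¼ :* w :* a)) refl

    decide : Dec (a * ¼ ≤ T M φ Bs G) → a * ¼ ≤ T M φ Bs G ⊎ LargeHybrid M φ Bs A α (¼ * inv (ℕ→ℚ (suc t)))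
    decide (yes large) = inj₁ large
    decide (no small) =
      let i , gᵢ<b = Σℚ-<-const (suc t) g b (hybrids-small (ℚP.≰⇒> small))
      in inj₂ (hybrid G H i , bounded i , i , hybrid-diagonal G H i , <-neg⇒≤∣∣ gᵢ<b)

propositionA9 : ∀ (q t r : ℕ) (V : Fin r → Fin t → ℤ) (φ : LinMap q t) →
    3 ℕ.≤ t → Setting q t r V φ →
    Σ ℚ λ c → ℚ.0ℚ ℚ.< c × Σ ℚ λ c′ → ℚ.0ℚ ℚ.< c′ ×
    ∀ (N M : ℕ) .{{_ : NonZero M}} → 1 ℕ.≤ N → Prime M →
    2 ℕ.* normφ φ ℕ.* N ℕ.< M → M ℕ.≤ 4 ℕ.* normφ φ ℕ.* N →
    ∀ (Bs : Fin (suc q) → Bohr M) →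
    (∀ k → ℚ.0ℚ ℚ.< radius (Bs k)) → (∀ k → Regular M (Bs k)) →
    ∀ (ρ : ℚ) → ρ ℚ.* ℕ→ℚ (dim M (Bs zero)) ℚ.≤ c →
    (∀ (i : Fin q) → _≤[_]_ M (Bs (suc i)) ρ (Bs (inject₁ i))) →
    ∀ (A : Subset M) → (∀ x → x ∈ A → _∈B_ M x (Bs zero)) →
    ∀ (α : ℚ) → α ℚ.* ℕ→ℚ (size M (Bs zero)) ≡ ℕ→ℚ ∣ A ∣ →
    (α ^ℚ t ℚ.* (ℚ.1ℚ ℚ.÷ ℕ→ℚ 4) ℚ.≤ T M φ Bs (λ _ → 𝟙 M A))
    ⊎ Σ (Fin t → Fin M → ℚ) λ f → (∀ i → Bounded M (f i)) ×
        Σ (Fin t) λ i → (∀ x → f i x ≡ 𝟙 M A x ℚ.- α ℚ.* 𝟙B M (Bs zero) x) ×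
        c′ ℚ.* α ^ℚ t ℚ.≤ ℚ.∣ T M φ Bs f ∣
propositionA9 q zero    r V φ () _
propositionA9 q (suc t) r V φ _ (_ , _ , _ , _ , _ , _ , _ , shape , _) =
  c[ φ ] , c[φ]-pos φ ,
  ¼ * inv (ℕ→ℚ (suc t)) , *-pos (ℚP.positive⁻¹ ¼) (inv-pos (ℕ→ℚ-pos t)) ,
  λ where
    N (suc m) _ _ _ _ Bs → counting-dichotomy m φ shape Bs
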